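{- Let $w\in S_n$, and regard $D^w$ as a polynomial in $x_1,\dots,x_n$ (so $\mathrm{Newton}(D^w)\subseteq\mathbb{R}^n$). Then $\mathrm{Newton}(D^w)$ is the generalized permutahedron $P_n^z(\{z_I\}_{I\subseteq[n]})$ with \[z_I=\sum_{(a,b)\in\mathrm{Inv}(w)}\mathbf{1}_{I\supseteq\{a,a+1,\dots,b-1\}}\qquad\text{for all } I\subseteq[n].\]
   Context: $S_n$ is the symmetric group on $[n]$; $\mathrm{Inv}(w)$ is the set of pairs $(a,b)$, $a<b$, with $w(a)>w(b)$, and $\ell(w)=|\mathrm{Inv}(w)|$. For $a<b$, $wt_{ab}$ swaps entries in positions $a,b$. Bruhat covers: $u\lessdot v$ iff $v=ut_{ab}$ ($a<b$) and $\ell(v)=\ell(u)+1$. Edge weight $m(u\lessdot ut_{ab})=x_a+\dots+x_{b-1}$; a saturated chain $C=(u_0\lessdot\cdots\lessdot u_\ell)$ has weight $m_C=\prod_i m(u_{i-1}\lessdot u_i)$. The dual Schubert polynomial is $D^w=\frac{1}{\ell(w)!}\sum_C m_C$ over saturated chains $C$ from $\mathrm{id}$ to $w$. The Newton polytope of a polynomial is the convex hull of its exponent vectors with nonzero coefficient. For real numbers $\{z_I\}_{I\subseteq[n]}$, the generalized permutahedron is $P_n^z(\{z_I\})=\{t\in\mathbb{R}^n: \sum_{i\in I}t_i\ge z_I \text{ for all } I\ne[n],\ \sum_{i=1}^n t_i=z_{[n]}\}$. $\mathbf{1}$ denotes the indicator (1 if the condition holds, 0 otherwise).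
   Formalization: The equality of $\mathrm{Newton}(D^w)$ with the generalized permutahedron is stated only for points with rational coordinates, with convex hulls formed from rational weights, rather than in $\mathbb{R}^n$. -}

module Defs where

open import Data.Bool using (Bool; true; false; if_then_else_; _∧_; _∨_; not; T)
open import Data.Nat as ℕ using (ℕ; zero; suc; _!)
open import Data.Nat.Properties using (_!≢0)
open import Data.Fin as Fin using (Fin; toℕ)
open import Data.Fin.Subset using (Subset)
open import Data.Product using (_×_; _,_; ∃; proj₁; proj₂)
open import Data.List as List using (List; []; _∷_; allFin; filterᵇ; concatMap; length; map; foldr; cartesianProduct)
open import Data.List.Relation.Unary.All using (All)
open import Data.Vec as Vec using (Vec; lookup; replicate; tabulate; zipWith)
open import Data.Vec.Properties using (≡-dec)
open import Data.Integer using (+_)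
open import Data.Rational as ℚ using (ℚ; 0ℚ; 1ℚ; _≤_; _/_)
open import Relation.Nullary using (¬_; does)
open import Relation.Binary.PropositionalEquality using (_≡_; _≢_)
open import Function using (_∘_)

-- Permutations of [n] (positions/values indexed by Fin n; Fin.zero ↔ 1).
-- An element of S_n is a function Fin n → Fin n that is injective
-- (injectivity is imposed as a hypothesis in the statement).

Perm : ℕ → Set
Perm n = Fin n → Fin n

idP : ∀ {n} → Perm n
idP i = i

swapPos : ∀ {n} → Perm n → Fin n → Fin n → Perm n
swapPos u a b i =
  if does (i Fin.≟ a) then u b else (if does (i Fin.≟ b) then u a else u i)

pairs : (n : ℕ) → List (Fin n × Fin n)
pairs n = filterᵇ (λ p → does (proj₁ p Fin.<? proj₂ p)) (cartesianProduct (allFin n) (allFin n))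

Inv : ∀ {n} → Perm n → List (Fin n × Fin n)
Inv {n} w = filterᵇ (λ p → does (w (proj₂ p) Fin.<? w (proj₁ p))) (pairs n)

len : ∀ {n} → Perm n → ℕ
len w = length (Inv w)

allᵇ : {A : Set} → (A → Bool) → List A → Bool
allᵇ p = foldr (λ x acc → p x ∧ acc) true

eqPᵇ : ∀ {n} → Perm n → Perm n → Bool
eqPᵇ {n} u v = allᵇ (λ i → does (u i Fin.≟ v i)) (allFin n)

coverᵇ : ∀ {n} → Perm n → Fin n × Fin n → Bool
coverᵇ u (a , b) = does (a Fin.<? b) ∧ does (len (swapPos u a b) ℕ.≟ suc (len u))

-- Saturated chains.  A chain u₀ ⋖ u₁ ⋖ ⋯ ⋖ u_k starting at u₀ is encoded by
-- the list of transpositions (a,b) with u_i = u_{i-1} t_ab.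

seqs : (n k : ℕ) → List (List (Fin n × Fin n))
seqs n zero    = [] ∷ []
seqs n (suc k) = concatMap (λ p → map (p ∷_) (seqs n k)) (pairs n)

isSatChainᵇ : ∀ {n} → Perm n → Perm n → List (Fin n × Fin n) → Bool
isSatChainᵇ u w []               = eqPᵇ u w
isSatChainᵇ u w ((a , b) ∷ rest) = coverᵇ u (a , b) ∧ isSatChainᵇ (swapPos u a b) w rest

-- All saturated chains from id to w.  (Every such chain has exactly ℓ(w)
-- steps, since each cover raises ℓ by one and ℓ(id) = 0.)
satChains : ∀ {n} → Perm n → List (List (Fin n × Fin n))
satChains {n} w = filterᵇ (isSatChainᵇ idP w) (seqs n (len w))

-- Polynomials in x₁,…,x_n with ℕ coefficients, represented as formal
-- sums of monomials (a list of exponent vectors, with multiplicity).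

Mono : ℕ → Set
Mono n = Vec ℕ n

Poly : ℕ → Set
Poly n = List (Mono n)

oneP : ∀ {n} → Poly n
oneP {n} = replicate n 0 ∷ []

_*P_ : ∀ {n} → Poly n → Poly n → Poly n
p *P q = concatMap (λ m → map (zipWith ℕ._+_ m) q) p

unitMono : ∀ {n} → Fin n → Mono n
unitMono i = tabulate (λ j → if does (j Fin.≟ i) then 1 else 0)

edgeWeight : ∀ {n} → Fin n × Fin n → Poly n
edgeWeight {n} (a , b) =
  map unitMono (filterᵇ (λ i → does (a Fin.≤? i) ∧ does (i Fin.<? b)) (allFin n))

chainWeight : ∀ {n} → List (Fin n × Fin n) → Poly n
chainWeight = foldr (λ e acc → edgeWeight e *P acc) oneP

sumChainWeights : ∀ {n} → Perm n → Poly n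
sumChainWeights w = concatMap chainWeight (satChains w)

coeffP : ∀ {n} → Poly n → Mono n → ℕ
coeffP p e = length (filterᵇ (λ m → does (≡-dec ℕ._≟_ m e)) p)

-- coefficient of x^e in D^w = (1/ℓ(w)!) Σ_C m_C
coeffD : ∀ {n} → Perm n → Mono n → ℚ
coeffD w e = ((+ coeffP (sumChainWeights w) e) / (len w !)) {{len w !≢0}}

Pt : ℕ → Set
Pt n = Fin n → ℚ

sumℚ : List ℚ → ℚ
sumℚ = foldr ℚ._+_ 0ℚ

InNewton : ∀ {n} → Perm n → Pt n → Set
InNewton {n} w t =
  ∃ λ (cs : List (ℚ × Mono n)) →
      All (λ c → (0ℚ ≤ proj₁ c) × (coeffD w (proj₂ c) ≢ 0ℚ)) cs
    × (sumℚ (map proj₁ cs) ≡ 1ℚ)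
    × (∀ i → sumℚ (map (λ c → proj₁ c ℚ.* ((+ lookup (proj₂ c) i) / 1)) cs) ≡ t i)

sumOver : ∀ {n} → Subset n → Pt n → ℚ
sumOver {n} I t = sumℚ (map t (filterᵇ (lookup I) (allFin n)))

InGenPerm : ∀ {n} → (Subset n → ℚ) → Pt n → Set
InGenPerm {n} z t =
    (∀ (I : Subset n) → I ≢ Data.Fin.Subset.⊤ → z I ≤ sumOver I t)
  × (sumOver Data.Fin.Subset.⊤ t ≡ z Data.Fin.Subset.⊤)

containsIntervalᵇ : ∀ {n} → Subset n → Fin n × Fin n → Bool
containsIntervalᵇ {n} I (a , b) =
  allᵇ (λ i → not (does (a Fin.≤? i) ∧ does (i Fin.<? b)) ∨ lookup I i) (allFin n)

zD : ∀ {n} → Perm n → Subset n → ℚ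
zD w I = (+ length (filterᵇ (containsIntervalᵇ I) (Inv w))) / 1

-- Both inclusions are about z_W(u), the number of inversions (p , q) of u selected by a
-- predicate W; the z_I of the statement is z_W(w) for W (p , q) = [p , q) ⊆ I.
--
-- Newton ⊆ permutahedron.  A monomial of D^w picks a variable x_c, a ≤ c < b, from every
-- cover u ⋖ u t_ab of a saturated chain from id to w.  A cover swaps u a < u b and no value
-- between them sits strictly between the positions a and b; this forces
-- z_I(u t_ab) ≤ z_I(u) + 1[[a , b) ⊆ I] ≤ z_I(u) + 1[c ∈ I].  Summing along the chain gives
-- z_I(w) ≤ Σ_{i ∈ I} m_i, with equality for I = [n] because every monomial has degree ℓ(w).
--
-- Permutahedron ⊆ Newton.  Undoing inversions with adjacent values one at a time yields a
-- saturated chain whose transpositions are exactly the inversions of w.  Its weight is the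
-- product of the forms x_a + ⋯ + x_{b-1}, whose Newton polytope is the Minkowski sum of the
-- simplices Δ[a , b).  For intervals I the inequalities of the permutahedron are the Hall
-- conditions of this sum, and they suffice: for the edge with the smallest b, subtract from
-- t its first unit of mass on [a , b), taken greedily from the left; the remainder satisfies
-- the Hall conditions of the other edges.

module Submission where

open import Defs
open import Data.Nat using (ℕ)
open import Function.Definitions using (Injective)
open import Relation.Binary.PropositionalEquality using (_≡_)
open import Function.Bundles using (_⇔_; mk⇔)

module Counting where

  open import Data.Bool using (Bool; true; false; T; _∧_; _∨_; not; if_then_else_)
  open import Data.Nat as ℕ using (ℕ; zero; suc; _+_; _≤_; z≤n; s≤s)
  import Data.Nat.Properties as ℕP
  open import Data.Nat.Tactic.RingSolver using (solve-∀)
  open import Data.Fin as Fin using (Fin; _≟_)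
  open import Data.Product using (_×_; _,_)
  open import Data.List as List using (List; []; _∷_; _++_; [_]; length; map; filterᵇ; tabulate; cartesianProduct)
  open import Data.List.Relation.Unary.All using (All; []; _∷_)
  open import Data.List.Relation.Unary.Any using (Any; here; there)
  open import Data.List.Properties using (filter-++; filter-none; length-++)
  open import Relation.Nullary using (¬_; Dec; does; yes; no; contradiction)
  open import Relation.Nullary.Decidable using (dec-true; T?)
  open import Relation.Binary.PropositionalEquality hiding ([_])
  open import Function using (_∘_; _⇔_; mk⇔; Equivalence)
  import Data.Vec.Functional as Vector
  import Algebra.Properties.Semiring.Sum as SemiringSum
  import Algebra.Properties.CommutativeSemigroup ℕP.+-commutativeSemigroup as ℕ+

  private variable
    A B : Set
    n : ℕ

  𝟙 : Bool → ℕ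
  𝟙 true  = 1
  𝟙 false = 0

  𝟙-∧-≤ : ∀ x y → 𝟙 (x ∧ y) ≤ 𝟙 y
  𝟙-∧-≤ true  y = ℕP.≤-refl
  𝟙-∧-≤ false y = z≤n

  𝟙-∧-mono : ∀ {x y} w → (T x → T y) → 𝟙 (x ∧ w) ≤ 𝟙 (y ∧ w)
  𝟙-∧-mono {false} w x⇒y = z≤n
  𝟙-∧-mono {true} {true} w x⇒y = ℕP.≤-refl
  𝟙-∧-mono {true} {false} w x⇒y with () ← x⇒y _

  𝟙-∧-cross : ∀ {x y α β} → (T x → T y) → (T α → T β) →
              𝟙 (y ∧ α) + 𝟙 (x ∧ β) ≤ 𝟙 (x ∧ α) + 𝟙 (y ∧ β)
  𝟙-∧-cross {true}  {true}                       _ _   = ℕP.≤-refl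
  𝟙-∧-cross {true}  {false}                      x⇒y _ with () ← x⇒y _
  𝟙-∧-cross {false} {false}                      _ _   = z≤n
  𝟙-∧-cross {false} {true}  {false}              _ _   = z≤n
  𝟙-∧-cross {false} {true}  {true}  {true}       _ _   = ℕP.≤-refl
  𝟙-∧-cross {false} {true}  {true}  {false}      _ α⇒β with () ← α⇒β _

  T-does : ∀ (d : Dec A) → A → T (does d)
  T-does d a = subst T (sym (dec-true d a)) _

  does⇒ : ∀ (d : Dec A) → T (does d) → A
  does⇒ (yes a) _ = a

  𝟙-mono : ∀ {x y} → (T x → T y) → 𝟙 x ≤ 𝟙 y
  𝟙-mono {false}          _   = z≤n
  𝟙-mono {true} {true}    _   = ℕP.≤-refl
  𝟙-mono {true} {false} x⇒y with () ← x⇒y _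

  T-implication : ∀ x y z → T (not (x ∧ y) ∨ z) ⇔ (T x → T y → T z)
  T-implication true  true  z = mk⇔ (λ t _ _ → t) (λ f → f _ _)
  T-implication true  false z = mk⇔ (λ _ _ ()) (λ _ → _)
  T-implication false y     z = mk⇔ (λ _ ()) (λ _ → _)

  T⇔T⇒≡ : ∀ {x y} → (T x ⇔ T y) → x ≡ y
  T⇔T⇒≡ {true}  {true}  _   = refl
  T⇔T⇒≡ {true}  {false} x⇔y = contradiction (Equivalence.to x⇔y _) λ ()
  T⇔T⇒≡ {false} {true}  x⇔y = contradiction (Equivalence.from x⇔y _) λ ()
  T⇔T⇒≡ {false} {false} _   = refl

  count : (A → Bool) → List A → ℕ
  count p xs = length (filterᵇ p xs)

  count-++ : ∀ (p : A → Bool) xs ys → count p (xs ++ ys) ≡ count p xs + count p ys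
  count-++ p xs ys = trans (cong length (filter-++ (T? ∘ p) xs ys)) (length-++ (filterᵇ p xs))

  count-map : ∀ (p : B → Bool) (f : A → B) xs → count p (map f xs) ≡ count (p ∘ f) xs
  count-map p f []       = refl
  count-map p f (x ∷ xs) with p (f x)
  ... | true  = cong suc (count-map p f xs)
  ... | false = count-map p f xs

  count-filterᵇ : ∀ (p q : A → Bool) xs → count p (filterᵇ q xs) ≡ count (λ x → q x ∧ p x) xs
  count-filterᵇ p q []       = refl
  count-filterᵇ p q (x ∷ xs) with q x
  ... | false = count-filterᵇ p q xs
  ... | true with p x
  ...   | true  = cong suc (count-filterᵇ p q xs)
  ...   | false = count-filterᵇ p q xs

  count-cong : ∀ {p q : A → Bool} {xs} → All (λ x → p x ≡ q x) xs → count p xs ≡ count q xs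
  count-cong [] = refl
  count-cong {p = p} {q} {x ∷ xs} (px≡qx ∷ eqs) with p x | q x
  ... | true  | true  = cong suc (count-cong eqs)
  ... | false | false = count-cong eqs

  count-mono : ∀ {p q : A → Bool} xs → (∀ x → T (p x) → T (q x)) → count p xs ≤ count q xs
  count-mono [] p⇒q = z≤n
  count-mono {p = p} {q} (x ∷ xs) p⇒q with p x | q x | p⇒q x
  ... | true  | true  | _   = s≤s (count-mono xs p⇒q)
  ... | true  | false | imp with () ← imp _
  ... | false | true  | _   = ℕP.m≤n⇒m≤1+n (count-mono xs p⇒q)
  ... | false | false | _   = count-mono xs p⇒q

  count-none : ∀ {p : A → Bool} {xs} → All (λ x → ¬ T (p x)) xs → count p xs ≡ 0
  count-none {p = p} none = cong length (filter-none (T? ∘ p) none)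

  count-true : ∀ (xs : List A) → count (λ _ → true) xs ≡ length xs
  count-true []       = refl
  count-true (x ∷ xs) = cong suc (count-true xs)

  count-singleton : ∀ (p : A → Bool) x → count p [ x ] ≡ 𝟙 (p x)
  count-singleton p x with p x
  ... | true  = refl
  ... | false = refl

  count-insert : ∀ (p : A → Bool) xs x ys → count p (xs ++ x ∷ ys) ≡ count p (xs ++ ys) + 𝟙 (p x)
  count-insert p []       x ys with p x
  ... | true  = ℕP.+-comm 1 _
  ... | false = sym (ℕP.+-identityʳ _)
  count-insert p (z ∷ xs) x ys with p z
  ... | true  = cong suc (count-insert p xs x ys)
  ... | false = count-insert p xs x ys

  length-insert : ∀ (xs : List A) x ys → length (xs ++ x ∷ ys) ≡ suc (length (xs ++ ys))
  length-insert []       x ys = refl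
  length-insert (z ∷ xs) x ys = cong suc (length-insert xs x ys)

  count≢0⇒any : ∀ (p : A → Bool) xs → count p xs ≢ 0 → Any (T ∘ p) xs
  count≢0⇒any p []       h = contradiction refl h
  count≢0⇒any p (x ∷ xs) h with p x in eq
  ... | true  = here (subst T (sym eq) _)
  ... | false = there (count≢0⇒any p xs h)

  module ∑ℕ = SemiringSum ℕP.+-*-semiring

  module _ {A C : Set} (_∙_ : C → C → C) (ε : C) (ε∙ : ∀ x → ε ∙ x ≡ x) where

    foldr-filterᵇ-tabulate : ∀ (P : A → Bool) (g : A → C) (f : Fin n → A) →
      List.foldr _∙_ ε (map g (filterᵇ P (tabulate f))) ≡ Vector.foldr _∙_ ε (λ i → if P (f i) then g (f i) else ε)
    foldr-filterᵇ-tabulate {zero}  P g f = refl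
    foldr-filterᵇ-tabulate {suc n} P g f with P (f Fin.zero)
    ... | true  = cong (g (f Fin.zero) ∙_) (foldr-filterᵇ-tabulate P g (f ∘ Fin.suc))
    ... | false = trans (foldr-filterᵇ-tabulate P g (f ∘ Fin.suc)) (sym (ε∙ _))

  ∑² : (Fin n → Fin n → ℕ) → ℕ
  ∑² f = ∑ℕ.sum λ p → ∑ℕ.sum (f p)

  ∑ℕ-mono : ∀ {f g : Fin n → ℕ} → (∀ i → f i ≤ g i) → ∑ℕ.sum f ≤ ∑ℕ.sum g
  ∑ℕ-mono {zero}  f≤g = z≤n
  ∑ℕ-mono {suc n} f≤g = ℕP.+-mono-≤ (f≤g Fin.zero) (∑ℕ-mono (f≤g ∘ Fin.suc))

  count-tabulate : ∀ (p : A → Bool) (f : Fin n → A) → count p (tabulate f) ≡ ∑ℕ.sum (𝟙 ∘ p ∘ f)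
  count-tabulate {n = zero}  p f = refl
  count-tabulate {n = suc n} p f with p (f Fin.zero)
  ... | true  = cong suc (count-tabulate p (f ∘ Fin.suc))
  ... | false = count-tabulate p (f ∘ Fin.suc)

  count-cartesianProduct : ∀ (p : A × B → Bool) (f : Fin n → A) ys →
    count p (cartesianProduct (tabulate f) ys) ≡ ∑ℕ.sum (λ i → count (λ y → p (f i , y)) ys)
  count-cartesianProduct {n = zero}  p f ys = refl
  count-cartesianProduct {n = suc n} p f ys = begin
    count p (map (f Fin.zero ,_) ys ++ cartesianProduct (tabulate (f ∘ Fin.suc)) ys)
      ≡⟨ count-++ p (map (f Fin.zero ,_) ys) _ ⟩
    count p (map (f Fin.zero ,_) ys) + count p (cartesianProduct (tabulate (f ∘ Fin.suc)) ys)
      ≡⟨ cong₂ _+_ (count-map p (f Fin.zero ,_) ys) (count-cartesianProduct p (f ∘ Fin.suc) ys) ⟩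
    ∑ℕ.sum (λ i → count (λ y → p (f i , y)) ys) ∎
    where open ≡-Reasoning

  without : Fin n → (Fin n → ℕ) → Fin n → ℕ
  without a h i = if does (i ≟ a) then 0 else h i

  without-≢ : ∀ {a i : Fin n} h → i ≢ a → without a h i ≡ h i
  without-≢ {a = a} {i} h i≢a with i ≟ a
  ... | yes i≡a = contradiction i≡a i≢a
  ... | no _    = refl

  sum-without : ∀ (h : Fin n → ℕ) a → ∑ℕ.sum h ≡ h a + ∑ℕ.sum (without a h)
  sum-without {suc n} h Fin.zero    = refl
  sum-without {suc n} h (Fin.suc a) = begin
    h Fin.zero + ∑ℕ.sum (h ∘ Fin.suc)
      ≡⟨ cong (h Fin.zero +_) (sum-without (h ∘ Fin.suc) a) ⟩
    h Fin.zero + (h (Fin.suc a) + ∑ℕ.sum (without a (h ∘ Fin.suc)))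
      ≡⟨ ℕ+.x∙yz≈y∙xz (h Fin.zero) (h (Fin.suc a)) _ ⟩
    h (Fin.suc a) + (h Fin.zero + ∑ℕ.sum (without a (h ∘ Fin.suc))) ∎
    where open ≡-Reasoning

  module _ {a b : Fin n} (a≢b : a ≢ b) where

    rest : (Fin n → ℕ) → ℕ
    rest h = ∑ℕ.sum (without b (without a h))

    sum≡pair+rest : ∀ h → ∑ℕ.sum h ≡ h a + h b + rest h
    sum≡pair+rest h = begin
      ∑ℕ.sum h                                           ≡⟨ sum-without h a ⟩
      h a + ∑ℕ.sum (without a h)                         ≡⟨ cong (h a +_) (sum-without (without a h) b) ⟩
      h a + (without a h b + rest h)                     ≡⟨ cong (λ x → h a + (x + rest h)) (without-≢ h (a≢b ∘ sym)) ⟩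
      h a + (h b + rest h)                               ≡⟨ ℕP.+-assoc (h a) _ _ ⟨
      h a + h b + rest h                                 ∎
      where open ≡-Reasoning

    without₂ : ∀ {R : ℕ → ℕ → Set} → R 0 0 → ∀ {h g : Fin n → ℕ} →
               (∀ i → i ≢ a → i ≢ b → R (h i) (g i)) → ∀ i → R (without b (without a h) i) (without b (without a g) i)
    without₂ R00 hRg i with i ≟ b
    ... | yes _ = R00
    ... | no i≢b with i ≟ a
    ...   | yes _   = R00
    ...   | no i≢a  = hRg i i≢a i≢b

    rest-mono : ∀ {h g : Fin n → ℕ} → (∀ i → i ≢ a → i ≢ b → h i ≤ g i) → rest h ≤ rest g
    rest-mono {h} {g} h≤g = ∑ℕ-mono (without₂ {R = _≤_} z≤n {h} {g} h≤g)

    rest-cong : ∀ {h g : Fin n → ℕ} → (∀ i → i ≢ a → i ≢ b → h i ≡ g i) → rest h ≡ rest g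
    rest-cong {h} {g} h≡g = ∑ℕ.sum-cong-≗ (without₂ {R = _≡_} refl {h} {g} h≡g)

    rest-+ : ∀ h g → rest (λ i → h i + g i) ≡ rest h + rest g
    rest-+ h g = trans (∑ℕ.sum-cong-≗ pointwise) (∑ℕ.∑-distrib-+ (without b (without a h)) _)
      where
      pointwise : ∀ i → without b (without a (λ i → h i + g i)) i ≡ without b (without a h) i + without b (without a g) i
      pointwise i with i ≟ b
      ... | yes _ = refl
      ... | no _ with i ≟ a
      ...   | yes _ = refl
      ...   | no _  = refl

    corner rows cols interior : (Fin n → Fin n → ℕ) → ℕ
    corner   f = (f a a + f a b) + (f b a + f b b)
    rows     f = rest (λ q → f a q + f b q)
    cols     f = rest (λ p → f p a + f p b)
    interior f = rest (λ p → rest (f p))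

    ∑²-cross : ∀ f → ∑² f ≡ corner f + cols f + (rows f + interior f)
    ∑²-cross f = begin
      ∑ℕ.sum (λ p → ∑ℕ.sum (f p))
        ≡⟨ ∑ℕ.sum-cong-≗ (λ p → sum≡pair+rest (f p)) ⟩
      ∑ℕ.sum (λ p → f p a + f p b + rest (f p))
        ≡⟨ ∑ℕ.∑-distrib-+ (λ p → f p a + f p b) (λ p → rest (f p)) ⟩
      ∑ℕ.sum (λ p → f p a + f p b) + ∑ℕ.sum (λ p → rest (f p))
        ≡⟨ cong₂ _+_ (sum≡pair+rest (λ p → f p a + f p b)) (sum≡pair+rest (λ p → rest (f p))) ⟩
      corner f + cols f + (rest (f a) + rest (f b) + interior f)
        ≡⟨ cong (λ x → corner f + cols f + (x + interior f)) (rest-+ (f a) (f b)) ⟨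
      corner f + cols f + (rows f + interior f) ∎
      where open ≡-Reasoning

    ∑²-cross-≤ : ∀ {f g k l} → corner f + k ≤ corner g + l →
      (∀ q → q ≢ a → q ≢ b → f a q + f b q ≤ g a q + g b q) →
      (∀ p → p ≢ a → p ≢ b → f p a + f p b ≤ g p a + g p b) →
      (∀ p → p ≢ a → p ≢ b → ∀ q → q ≢ a → q ≢ b → f p q ≤ g p q) →
      ∑² f + k ≤ ∑² g + l
    ∑²-cross-≤ {f} {g} {k} {l} corner≤ rows≤ cols≤ interior≤ =
      subst₂ _≤_ (sym (moveK f k)) (sym (moveK g l))
        (ℕP.+-mono-≤ corner≤ (ℕP.+-mono-≤ (rest-mono cols≤)
          (ℕP.+-mono-≤ (rest-mono rows≤) (rest-mono λ p p≢a p≢b → rest-mono (interior≤ p p≢a p≢b)))))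
      where
      moveK : ∀ h m → ∑² h + m ≡ corner h + m + (cols h + (rows h + interior h))
      moveK h m = trans (cong (_+ m) (∑²-cross h)) (rearrange (corner h) (cols h) (rows h + interior h) m)
        where
        rearrange : ∀ c o r m → c + o + r + m ≡ c + m + (o + r)
        rearrange = solve-∀

    ∑²-cross-≡ : ∀ {f g k} → corner f ≡ corner g + k →
      (∀ q → q ≢ a → q ≢ b → f a q + f b q ≡ g a q + g b q) →
      (∀ p → p ≢ a → p ≢ b → f p a + f p b ≡ g p a + g p b) →
      (∀ p → p ≢ a → p ≢ b → ∀ q → q ≢ a → q ≢ b → f p q ≡ g p q) →
      ∑² f ≡ ∑² g + k
    ∑²-cross-≡ {f} {g} {k} corner≡ rows≡ cols≡ interior≡ = begin
      ∑² f                                        ≡⟨ ∑²-cross f ⟩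
      corner f + cols f + (rows f + interior f)
        ≡⟨ cong₂ (λ x y → x + cols f + y) corner≡
             (cong₂ _+_ (rest-cong rows≡) (rest-cong λ p p≢a p≢b → rest-cong (interior≡ p p≢a p≢b))) ⟩
      corner g + k + cols f + (rows g + interior g) ≡⟨ cong (λ x → corner g + k + x + (rows g + interior g)) (rest-cong cols≡) ⟩
      corner g + k + cols g + (rows g + interior g) ≡⟨ rearrange (corner g) k (cols g) (rows g + interior g) ⟩
      corner g + cols g + (rows g + interior g) + k ≡⟨ cong (_+ k) (∑²-cross g) ⟨
      ∑² g + k                                    ∎
      where
      open ≡-Reasoning
      rearrange : ∀ c k o r → c + k + o + r ≡ c + o + r + k
      rearrange = solve-∀

module Inversions where

  open import Data.Bool using (Bool; true; false; T; _∧_)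
  open import Data.Nat as ℕ using (ℕ)
  import Data.Nat.Properties as ℕP
  open import Data.Fin as Fin using (Fin; toℕ; _<_; _<?_; _≟_)
  open import Data.Product using (_×_; _,_; proj₁; proj₂)
  open import Data.List using (allFin; cartesianProduct)
  open import Relation.Binary.PropositionalEquality
  open import Relation.Nullary using (¬_; Dec; does; yes; no; contradiction)
  open import Relation.Nullary.Decidable using (dec-true; dec-false)
  open import Function using (_∘_)
  open import Function.Definitions using (Injective)
  open Counting

  private variable
    n : ℕ

  _<ᵇ_ : Fin n → Fin n → Bool
  i <ᵇ j = does (i <? j)

  <ᵇ-true : ∀ {i j : Fin n} → i < j → i <ᵇ j ≡ true
  <ᵇ-true {i = i} {j} = dec-true (i <? j)

  <ᵇ-false : ∀ {i j : Fin n} → ¬ i < j → i <ᵇ j ≡ false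
  <ᵇ-false {i = i} {j} = dec-false (i <? j)

  <ᵇ⇒< : ∀ {i j : Fin n} → T (i <ᵇ j) → i < j
  <ᵇ⇒< {i = i} {j} = ℕP.<ᵇ⇒< (toℕ i) (toℕ j)

  <⇒<ᵇ : ∀ {i j : Fin n} → i < j → T (i <ᵇ j)
  <⇒<ᵇ = ℕP.<⇒<ᵇ

  <ᵇ-lift : ∀ {i j k l : Fin n} → (i < j → k < l) → T (i <ᵇ j) → T (k <ᵇ l)
  <ᵇ-lift f = <⇒<ᵇ ∘ f ∘ <ᵇ⇒<

  inv𝟙 : Perm n → (Fin n × Fin n → Bool) → Fin n → Fin n → ℕ
  inv𝟙 x W p q = 𝟙 (p <ᵇ q ∧ (x q <ᵇ x p ∧ W (p , q)))

  invCount : (Fin n × Fin n → Bool) → Perm n → ℕ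
  invCount W x = count W (Inv x)

  invCount≡∑² : ∀ W (x : Perm n) → invCount W x ≡ ∑² (inv𝟙 x W)
  invCount≡∑² {n} W x = begin
    count W (Inv x)
      ≡⟨ count-filterᵇ W (λ e → x (proj₂ e) <ᵇ x (proj₁ e)) (pairs n) ⟩
    count (λ e → x (proj₂ e) <ᵇ x (proj₁ e) ∧ W e) (pairs n)
      ≡⟨ count-filterᵇ (λ e → x (proj₂ e) <ᵇ x (proj₁ e) ∧ W e) (λ e → proj₁ e <ᵇ proj₂ e)
                       (cartesianProduct (allFin n) (allFin n)) ⟩
    count (λ e → proj₁ e <ᵇ proj₂ e ∧ (x (proj₂ e) <ᵇ x (proj₁ e) ∧ W e)) (cartesianProduct (allFin n) (allFin n))
      ≡⟨ count-cartesianProduct (λ e → proj₁ e <ᵇ proj₂ e ∧ (x (proj₂ e) <ᵇ x (proj₁ e) ∧ W e)) (λ i → i) (allFin n) ⟩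
    ∑ℕ.sum (λ p → count (λ q → p <ᵇ q ∧ (x q <ᵇ x p ∧ W (p , q))) (allFin n))
      ≡⟨ ∑ℕ.sum-cong-≗ (λ p → count-tabulate (λ q → p <ᵇ q ∧ (x q <ᵇ x p ∧ W (p , q))) (λ i → i)) ⟩
    ∑² (inv𝟙 x W) ∎
    where
    open ≡-Reasoning

  len≡invCount : (x : Perm n) → len x ≡ invCount (λ _ → true) x
  len≡invCount x = sym (count-true (Inv x))

  invCount-cong : ∀ W {x y : Perm n} → (∀ i → x i ≡ y i) → invCount W x ≡ invCount W y
  invCount-cong W {x} {y} x≗y = begin
    invCount W x     ≡⟨ invCount≡∑² W x ⟩
    ∑² (inv𝟙 x W)    ≡⟨ ∑ℕ.sum-cong-≗ (λ p → ∑ℕ.sum-cong-≗ λ q →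
                            cong₂ (λ c d → 𝟙 (p <ᵇ q ∧ (c <ᵇ d ∧ W (p , q)))) (x≗y q) (x≗y p)) ⟩
    ∑² (inv𝟙 y W)    ≡⟨ invCount≡∑² W y ⟨
    invCount W y     ∎
    where open ≡-Reasoning

  len-cong : {x y : Perm n} → (∀ i → x i ≡ y i) → len x ≡ len y
  len-cong {x = x} {y} x≗y = trans (len≡invCount x) (trans (invCount-cong _ x≗y) (sym (len≡invCount y)))

  swapPos-a : ∀ (u : Perm n) a b → swapPos u a b a ≡ u b
  swapPos-a u a b with a ≟ a
  ... | yes _   = refl
  ... | no a≢a  = contradiction refl a≢a

  module _ (u : Perm n) {a b : Fin n} where

    swapPos-b : a ≢ b → swapPos u a b b ≡ u a
    swapPos-b a≢b with b ≟ a
    ... | yes b≡a = contradiction (sym b≡a) a≢b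
    ... | no _ with b ≟ b
    ...   | yes _   = refl
    ...   | no b≢b  = contradiction refl b≢b

    swapPos-≢ : ∀ {i} → i ≢ a → i ≢ b → swapPos u a b i ≡ u i
    swapPos-≢ {i} i≢a i≢b with i ≟ a
    ... | yes i≡a = contradiction i≡a i≢a
    ... | no _ with i ≟ b
    ...   | yes i≡b = contradiction i≡b i≢b
    ...   | no _    = refl

    swapPos-involutive : a ≢ b → ∀ i → swapPos (swapPos u a b) a b i ≡ u i
    swapPos-involutive a≢b i with i ≟ a
    ... | yes refl = swapPos-b a≢b
    ... | no i≢a with i ≟ b
    ...   | yes refl = swapPos-a u a b
    ...   | no _     = refl

    swapPos-∘ : ∀ i → swapPos u a b i ≡ u (swapPos idP a b i)
    swapPos-∘ i with i ≟ a
    ... | yes _ = refl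
    ... | no _ with i ≟ b
    ...   | yes _ = refl
    ...   | no _  = refl

  swapPos-cong : ∀ {u v : Perm n} a b → (∀ i → u i ≡ v i) → ∀ i → swapPos u a b i ≡ swapPos v a b i
  swapPos-cong {u = u} {v} a b u≗v i = trans (swapPos-∘ u i) (trans (u≗v _) (sym (swapPos-∘ v i)))

  swapPos-injective : ∀ {u : Perm n} {a b} → a ≢ b → Injective _≡_ _≡_ u → Injective _≡_ _≡_ (swapPos u a b)
  swapPos-injective {u = u} {a} {b} a≢b u-inj {i} {j} eq = begin
    i                                      ≡⟨ τ-involutive i ⟨
    swapPos idP a b (swapPos idP a b i)    ≡⟨ cong (swapPos idP a b) (u-inj (trans (sym (swapPos-∘ u i))
                                                                                (trans eq (swapPos-∘ u j)))) ⟩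
    swapPos idP a b (swapPos idP a b j)    ≡⟨ τ-involutive j ⟩
    j                                      ∎
    where
    open ≡-Reasoning
    τ-involutive : ∀ k → swapPos idP a b (swapPos idP a b k) ≡ k
    τ-involutive k = trans (sym (swapPos-∘ (swapPos idP a b) k)) (swapPos-involutive idP a≢b k)

  swapPos-conjugate : ∀ (u : Perm n) {a p b} → a ≢ p → p ≢ b → a ≢ b →
    ∀ i → swapPos (swapPos (swapPos u a p) p b) a p i ≡ swapPos u a b i
  swapPos-conjugate u {a} {p} {b} a≢p p≢b a≢b i = by-cases i (i ≟ a) (i ≟ p) (i ≟ b)
    where
    open ≡-Reasoning
    by-cases : ∀ i → Dec (i ≡ a) → Dec (i ≡ p) → Dec (i ≡ b) →
               swapPos (swapPos (swapPos u a p) p b) a p i ≡ swapPos u a b i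
    by-cases _ (yes refl) _ _ = begin
      swapPos (swapPos (swapPos u a p) p b) a p a  ≡⟨ swapPos-a (swapPos (swapPos u a p) p b) a p ⟩
      swapPos (swapPos u a p) p b p                ≡⟨ swapPos-a (swapPos u a p) p b ⟩
      swapPos u a p b                              ≡⟨ swapPos-≢ u (a≢b ∘ sym) (p≢b ∘ sym) ⟩
      u b                                          ≡⟨ swapPos-a u a b ⟨
      swapPos u a b a                              ∎
    by-cases _ (no i≢a) (yes refl) _ = begin
      swapPos (swapPos (swapPos u a p) p b) a p p  ≡⟨ swapPos-b (swapPos (swapPos u a p) p b) a≢p ⟩
      swapPos (swapPos u a p) p b a                ≡⟨ swapPos-≢ (swapPos u a p) a≢p a≢b ⟩
      swapPos u a p a                              ≡⟨ swapPos-a u a p ⟩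
      u p                                          ≡⟨ swapPos-≢ u i≢a p≢b ⟨
      swapPos u a b p                              ∎
    by-cases _ (no i≢a) (no i≢p) (yes refl) = begin
      swapPos (swapPos (swapPos u a p) p b) a p b  ≡⟨ swapPos-≢ (swapPos (swapPos u a p) p b) i≢a i≢p ⟩
      swapPos (swapPos u a p) p b b                ≡⟨ swapPos-b (swapPos u a p) p≢b ⟩
      swapPos u a p p                              ≡⟨ swapPos-b u a≢p ⟩
      u a                                          ≡⟨ swapPos-b u a≢b ⟨
      swapPos u a b b                              ∎
    by-cases i (no i≢a) (no i≢p) (no i≢b) = begin
      swapPos (swapPos (swapPos u a p) p b) a p i  ≡⟨ swapPos-≢ (swapPos (swapPos u a p) p b) i≢a i≢p ⟩
      swapPos (swapPos u a p) p b i                ≡⟨ swapPos-≢ (swapPos u a p) i≢p i≢b ⟩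
      swapPos u a p i                              ≡⟨ swapPos-≢ u i≢a i≢p ⟩
      u i                                          ≡⟨ swapPos-≢ u i≢a i≢b ⟨
      swapPos u a b i                              ∎

module SwapComparison where

  open import Data.Bool using (Bool; _∧_)
  open import Data.Nat as ℕ using (ℕ; _+_; _≤_)
  import Data.Nat.Properties as ℕP
  open import Data.Fin as Fin using (Fin; _<_)
  open import Data.Fin.Properties using (<-trans; <-asym; <-irrefl; <-cmp; <⇒≢)
  open import Data.Product using (_×_; _,_; proj₁; proj₂)
  open import Relation.Binary using (tri<; tri≈; tri>)
  open import Relation.Binary.PropositionalEquality
  open import Relation.Nullary using (contradiction)
  open import Function using (_∘_)
  open Counting
  open Inversions

  private variable
    n : ℕ

  data Region {n} (a b i : Fin n) : Set where
    before  : i < a → Region a b i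
    between : a < i → i < b → Region a b i
    after   : b < i → Region a b i

  module _ {a b : Fin n} (a<b : a < b) where

    region : ∀ {i} → i ≢ a → i ≢ b → Region a b i
    region {i} i≢a i≢b with <-cmp i a
    ... | tri< i<a _ _ = before i<a
    ... | tri≈ _ i≡a _ = contradiction i≡a i≢a
    ... | tri> _ _ a<i with <-cmp i b
    ...   | tri< i<b _ _ = between a<i i<b
    ...   | tri≈ _ i≡b _ = contradiction i≡b i≢b
    ...   | tri> _ _ b<i = after b<i

    region-≢ : ∀ {i} → Region a b i → i ≢ a × i ≢ b
    region-≢ (before i<a)      = <⇒≢ i<a , <⇒≢ (<-trans i<a a<b)
    region-≢ (between a<i i<b) = <⇒≢ a<i ∘ sym , <⇒≢ i<b
    region-≢ (after b<i)       = <⇒≢ (<-trans a<b b<i) ∘ sym , <⇒≢ b<i ∘ sym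

    module _ (W : Fin n × Fin n → Bool) where

      -- The rows a, b (resp. columns a, b) of ∑² (inv𝟙 x W) at an index outside {a, b}, when x
      -- takes the values γ, α, β at that index, at a and at b.
      rowPair : ∀ {q} → Region a b q → (γ α β : Fin n) → ℕ
      rowPair     (before _)    γ α β = 0
      rowPair {q} (between _ _) γ α β = 𝟙 (γ <ᵇ α ∧ W (a , q))
      rowPair {q} (after _)     γ α β = 𝟙 (γ <ᵇ α ∧ W (a , q)) + 𝟙 (γ <ᵇ β ∧ W (b , q))

      colPair : ∀ {p} → Region a b p → (γ α β : Fin n) → ℕ
      colPair {p} (before _)    γ α β = 𝟙 (α <ᵇ γ ∧ W (p , a)) + 𝟙 (β <ᵇ γ ∧ W (p , b))
      colPair {p} (between _ _) γ α β = 𝟙 (β <ᵇ γ ∧ W (p , b))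
      colPair     (after _)     γ α β = 0

      rowPair-eval : ∀ (x : Perm n) {q} (r : Region a b q) →
                     inv𝟙 x W a q + inv𝟙 x W b q ≡ rowPair r (x q) (x a) (x b)
      rowPair-eval x (before q<a)
        rewrite <ᵇ-false (<-asym q<a) | <ᵇ-false (<-asym (<-trans q<a a<b)) = refl
      rowPair-eval x (between a<q q<b)
        rewrite <ᵇ-true a<q | <ᵇ-false (<-asym q<b) = ℕP.+-identityʳ _
      rowPair-eval x (after b<q)
        rewrite <ᵇ-true (<-trans a<b b<q) | <ᵇ-true b<q = refl

      colPair-eval : ∀ (x : Perm n) {p} (r : Region a b p) →
                     inv𝟙 x W p a + inv𝟙 x W p b ≡ colPair r (x p) (x a) (x b)
      colPair-eval x (before p<a)
        rewrite <ᵇ-true p<a | <ᵇ-true (<-trans p<a a<b) = refl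
      colPair-eval x (between a<p p<b)
        rewrite <ᵇ-false (<-asym a<p) | <ᵇ-true p<b = refl
      colPair-eval x (after b<p)
        rewrite <ᵇ-false (<-asym (<-trans a<b b<p)) | <ᵇ-false (<-asym b<p) = refl

      corner-eval : ∀ (x : Perm n) → corner (<⇒≢ a<b) (inv𝟙 x W) ≡ 𝟙 (x b <ᵇ x a ∧ W (a , b))
      corner-eval x
        rewrite <ᵇ-false (<-irrefl {x = a} refl) | <ᵇ-false (<-irrefl {x = b} refl)
              | <ᵇ-true a<b | <ᵇ-false (<-asym a<b) = ℕP.+-identityʳ _

      rowPair-cong : ∀ {q} (r : Region a b q) {γ α β γ′ α′ β′} → γ ≡ γ′ → α ≡ α′ → β ≡ β′ →
                     rowPair r γ α β ≡ rowPair r γ′ α′ β′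
      rowPair-cong r refl refl refl = refl

      colPair-cong : ∀ {p} (r : Region a b p) {γ α β γ′ α′ β′} → γ ≡ γ′ → α ≡ α′ → β ≡ β′ →
                     colPair r γ α β ≡ colPair r γ′ α′ β′
      colPair-cong r refl refl refl = refl

  module SwapAt (W : Fin n × Fin n → Bool) (u : Perm n) {a b : Fin n} (a<b : a < b) where

    private
      a≢b = <⇒≢ a<b
      v = swapPos u a b

      rowPair-swap : ∀ {q} (r : Region a b q) → inv𝟙 v W a q + inv𝟙 v W b q ≡ rowPair a<b W r (u q) (u b) (u a)
      rowPair-swap {q} r = trans (rowPair-eval a<b W v r)
        (rowPair-cong a<b W r (swapPos-≢ u q≢a q≢b) (swapPos-a u a b) (swapPos-b u a≢b))
        where q≢a = proj₁ (region-≢ a<b r); q≢b = proj₂ (region-≢ a<b r)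

      colPair-swap : ∀ {p} (r : Region a b p) → inv𝟙 v W p a + inv𝟙 v W p b ≡ colPair a<b W r (u p) (u b) (u a)
      colPair-swap {p} r = trans (colPair-eval a<b W v r)
        (colPair-cong a<b W r (swapPos-≢ u p≢a p≢b) (swapPos-a u a b) (swapPos-b u a≢b))
        where p≢a = proj₁ (region-≢ a<b r); p≢b = proj₂ (region-≢ a<b r)

      corner-swap : corner a≢b (inv𝟙 v W) ≡ 𝟙 (u a <ᵇ u b ∧ W (a , b))
      corner-swap = trans (corner-eval a<b W v)
        (cong₂ (λ c d → 𝟙 (c <ᵇ d ∧ W (a , b))) (swapPos-b u a≢b) (swapPos-a u a b))

      interior-swap : ∀ p → p ≢ a → p ≢ b → ∀ q → q ≢ a → q ≢ b → inv𝟙 v W p q ≡ inv𝟙 u W p q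
      interior-swap p p≢a p≢b q q≢a q≢b =
        cong₂ (λ c d → 𝟙 (p <ᵇ q ∧ (c <ᵇ d ∧ W (p , q)))) (swapPos-≢ u q≢a q≢b) (swapPos-≢ u p≢a p≢b)

    invCount-swap-≤ : ∀ {k l} →
      𝟙 (u a <ᵇ u b ∧ W (a , b)) + k ≤ 𝟙 (u b <ᵇ u a ∧ W (a , b)) + l →
      (∀ {q} (r : Region a b q) → rowPair a<b W r (u q) (u b) (u a) ≤ rowPair a<b W r (u q) (u a) (u b)) →
      (∀ {p} (r : Region a b p) → colPair a<b W r (u p) (u b) (u a) ≤ colPair a<b W r (u p) (u a) (u b)) →
      invCount W v + k ≤ invCount W u + l
    invCount-swap-≤ {k} {l} corner≤ rows≤ cols≤ =
      subst₂ (λ x y → x + k ≤ y + l) (sym (invCount≡∑² W v)) (sym (invCount≡∑² W u))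
        (∑²-cross-≤ a≢b
          (subst₂ (λ x y → x + k ≤ y + l) (sym corner-swap) (sym (corner-eval a<b W u)) corner≤)
          (λ q q≢a q≢b → let r = region a<b q≢a q≢b in
            subst₂ _≤_ (sym (rowPair-swap r)) (sym (rowPair-eval a<b W u r)) (rows≤ r))
          (λ p p≢a p≢b → let r = region a<b p≢a p≢b in
            subst₂ _≤_ (sym (colPair-swap r)) (sym (colPair-eval a<b W u r)) (cols≤ r))
          (λ p p≢a p≢b q q≢a q≢b → ℕP.≤-reflexive (interior-swap p p≢a p≢b q q≢a q≢b)))

    invCount-swap-≥ : ∀ {k l} →
      𝟙 (u b <ᵇ u a ∧ W (a , b)) + k ≤ 𝟙 (u a <ᵇ u b ∧ W (a , b)) + l →
      (∀ {q} (r : Region a b q) → rowPair a<b W r (u q) (u a) (u b) ≤ rowPair a<b W r (u q) (u b) (u a)) →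
      (∀ {p} (r : Region a b p) → colPair a<b W r (u p) (u a) (u b) ≤ colPair a<b W r (u p) (u b) (u a)) →
      invCount W u + k ≤ invCount W v + l
    invCount-swap-≥ {k} {l} corner≤ rows≤ cols≤ =
      subst₂ (λ x y → x + k ≤ y + l) (sym (invCount≡∑² W u)) (sym (invCount≡∑² W v))
        (∑²-cross-≤ a≢b
          (subst₂ (λ x y → x + k ≤ y + l) (sym (corner-eval a<b W u)) (sym corner-swap) corner≤)
          (λ q q≢a q≢b → let r = region a<b q≢a q≢b in
            subst₂ _≤_ (sym (rowPair-eval a<b W u r)) (sym (rowPair-swap r)) (rows≤ r))
          (λ p p≢a p≢b → let r = region a<b p≢a p≢b in
            subst₂ _≤_ (sym (colPair-eval a<b W u r)) (sym (colPair-swap r)) (cols≤ r))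
          (λ p p≢a p≢b q q≢a q≢b → ℕP.≤-reflexive (sym (interior-swap p p≢a p≢b q q≢a q≢b))))

    invCount-swap-≡ : ∀ {k} →
      𝟙 (u a <ᵇ u b ∧ W (a , b)) ≡ 𝟙 (u b <ᵇ u a ∧ W (a , b)) + k →
      (∀ {q} (r : Region a b q) → rowPair a<b W r (u q) (u b) (u a) ≡ rowPair a<b W r (u q) (u a) (u b)) →
      (∀ {p} (r : Region a b p) → colPair a<b W r (u p) (u b) (u a) ≡ colPair a<b W r (u p) (u a) (u b)) →
      invCount W v ≡ invCount W u + k
    invCount-swap-≡ {k} corner≡ rows≡ cols≡ =
      subst₂ (λ x y → x ≡ y + k) (sym (invCount≡∑² W v)) (sym (invCount≡∑² W u))
        (∑²-cross-≡ a≢b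
          (subst₂ (λ x y → x ≡ y + k) (sym corner-swap) (sym (corner-eval a<b W u)) corner≡)
          (λ q q≢a q≢b → let r = region a<b q≢a q≢b in
            trans (rowPair-swap r) (trans (rows≡ r) (sym (rowPair-eval a<b W u r))))
          (λ p p≢a p≢b → let r = region a<b p≢a p≢b in
            trans (colPair-swap r) (trans (cols≡ r) (sym (colPair-eval a<b W u r))))
          interior-swap)

module Covers where

  open import Data.Bool using (Bool; true; T; _∧_)
  open import Data.Nat as ℕ using (ℕ; suc; _+_; _≤_; z≤n)
  import Data.Nat.Properties as ℕP
  open import Data.Fin as Fin using (Fin; toℕ; _<_; _<?_)
  open import Data.Fin.Properties using (<-trans; <-asym; <-cmp; <⇒≢; ≤∧≢⇒<)
  open import Data.Product using (_×_; _,_; proj₁; proj₂)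
  open import Relation.Binary using (tri<; tri≈; tri>)
  open import Relation.Binary.PropositionalEquality
  open import Data.Empty using (⊥)
  open import Relation.Nullary using (contradiction)
  open import Relation.Nullary.Decidable using (does-⇔)
  open import Function using (_∘_; _$_; mk⇔)
  open import Function.Definitions using (Injective)
  open Counting
  open Inversions
  open SwapComparison

  private variable
    n : ℕ

  len-swap-< : ∀ (u : Perm n) {a b} → a < b → u a < u b → len u ℕ.< len (swapPos u a b)
  len-swap-< u {a} {b} a<b ua<ub = begin
    suc (len u)                         ≡⟨ cong suc (len≡invCount u) ⟩
    suc (invCount all u)                ≡⟨ ℕP.+-comm 1 _ ⟩
    invCount all u + 1                  ≤⟨ invCount-swap-≥ corner≤ rows≤ cols≤ ⟩
    invCount all (swapPos u a b) + 0    ≡⟨ ℕP.+-identityʳ _ ⟩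
    invCount all (swapPos u a b)        ≡⟨ len≡invCount (swapPos u a b) ⟨
    len (swapPos u a b)                 ∎
    where
    open ℕP.≤-Reasoning
    open SwapAt (λ _ → true) u a<b
    all : Fin n × Fin n → Bool
    all _ = true
    corner≤ : 𝟙 (u b <ᵇ u a ∧ true) + 1 ≤ 𝟙 (u a <ᵇ u b ∧ true) + 0
    corner≤ rewrite <ᵇ-true ua<ub | <ᵇ-false (<-asym ua<ub) = ℕP.≤-refl
    rows≤ : ∀ {q} (r : Region a b q) → rowPair a<b _ r (u q) (u a) (u b) ≤ rowPair a<b _ r (u q) (u b) (u a)
    rows≤ (before _)    = z≤n
    rows≤ {q} (between _ _) = 𝟙-∧-mono true (<ᵇ-lift {i = u q} {u a} {u q} {u b} (λ uq<ua → <-trans uq<ua ua<ub))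
    rows≤ {q} (after _) = ℕP.≤-reflexive (ℕP.+-comm (𝟙 (u q <ᵇ u a ∧ true)) _)
    cols≤ : ∀ {p} (r : Region a b p) → colPair a<b _ r (u p) (u a) (u b) ≤ colPair a<b _ r (u p) (u b) (u a)
    cols≤ {p} (before _) = ℕP.≤-reflexive (ℕP.+-comm (𝟙 (u a <ᵇ u p ∧ true)) _)
    cols≤ {p} (between _ _) = 𝟙-∧-mono true (<ᵇ-lift {i = u b} {u p} {u a} {u p} (<-trans ua<ub))
    cols≤ (after _)     = z≤n

  module Cover (u : Perm n) (u-inj : Injective _≡_ _≡_ u) {a b : Fin n} (a<b : a < b)
               (cover : len (swapPos u a b) ≡ suc (len u)) where

    private
      a≢b = <⇒≢ a<b
      v = swapPos u a b
      len-u<len-v : len u ℕ.< len v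
      len-u<len-v = ℕP.≤-reflexive (sym cover)

    -- Otherwise u = swapPos v a b with v a < v b, which would make u longer than v.
    increasing : u a < u b
    increasing with <-cmp (u a) (u b)
    ... | tri< ua<ub _ _ = ua<ub
    ... | tri≈ _ ua≡ub _ = contradiction (u-inj ua≡ub) a≢b
    ... | tri> _ _ ub<ua = contradiction len-u<len-v $ ℕP.<-asym $
      (subst (len v ℕ.<_) (len-cong (swapPos-involutive u a≢b))
        (len-swap-< v a<b (subst₂ _<_ (sym (swapPos-a u a b)) (sym (swapPos-b u a≢b)) ub<ua)))

    -- Then t_ab = t_ap t_pb t_ap is a product of three length-increasing swaps.
    no-middle : ∀ {p} → a < p → p < b → u a < u p → u p < u b → ⊥
    no-middle {p} a<p p<b ua<up up<ub = ℕP.<-irrefl refl (begin-strict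
      suc (len u)                                          <⟨ ℕP.+-monoʳ-< 1 (len-swap-< u a<p ua<up) ⟩
      suc (len u₁)                                         <⟨ ℕP.+-monoʳ-< 1 (len-swap-< u₁ p<b u₁p<u₁b) ⟩
      suc (len u₂)                                         ≤⟨ len-swap-< u₂ a<p u₂a<u₂p ⟩
      len (swapPos u₂ a p)                                 ≡⟨ len-cong (swapPos-conjugate u a≢p p≢b a≢b) ⟩
      len v                                                ≡⟨ cover ⟩
      suc (len u)                                          ∎)
      where
      open ℕP.≤-Reasoning
      a≢p = <⇒≢ a<p
      p≢b = <⇒≢ p<b
      u₁ = swapPos u a p
      u₂ = swapPos u₁ p b
      u₁p<u₁b : u₁ p < u₁ b
      u₁p<u₁b = subst₂ _<_ (sym (swapPos-b u a≢p)) (sym (swapPos-≢ u (a≢b ∘ sym) (p≢b ∘ sym))) (<-trans ua<up up<ub)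
      u₂a<u₂p : u₂ a < u₂ p
      u₂a<u₂p = subst₂ _<_ (sym (trans (swapPos-≢ u₁ a≢p a≢b) (swapPos-a u a p)))
                           (sym (trans (swapPos-a u₁ p b) (swapPos-≢ u (a≢b ∘ sym) (p≢b ∘ sym)))) up<ub

    no-middle⁺ : ∀ {p} → a < p → p < b → u a < u p → u b < u p
    no-middle⁺ {p} a<p p<b ua<up with <-cmp (u p) (u b)
    ... | tri< up<ub _ _ = contradiction up<ub (no-middle a<p p<b ua<up)
    ... | tri≈ _ up≡ub _ = contradiction (u-inj up≡ub) (<⇒≢ p<b)
    ... | tri> _ _ ub<up = ub<up

    no-middle⁻ : ∀ {p} → a < p → p < b → u p < u b → u p < u a
    no-middle⁻ {p} a<p p<b up<ub with <-cmp (u p) (u a)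
    ... | tri< up<ua _ _ = up<ua
    ... | tri≈ _ up≡ua _ = contradiction (sym (u-inj up≡ua)) (<⇒≢ a<p)
    ... | tri> _ _ ua<up = contradiction up<ub (no-middle a<p p<b ua<up)

    invCount-cover : ∀ W → (∀ {p} → p < a → T (W (p , b)) → T (W (p , a))) →
                     (∀ {q} → b < q → T (W (a , q)) → T (W (b , q))) →
                     invCount W v ≤ invCount W u + 𝟙 (W (a , b))
    invCount-cover W W-left W-right = subst (_≤ invCount W u + 𝟙 (W (a , b))) (ℕP.+-identityʳ _)
      (invCount-swap-≤ corner≤ rows≤ cols≤)
      where
      open SwapAt W u a<b
      ua<ub = increasing
      corner≤ : 𝟙 (u a <ᵇ u b ∧ W (a , b)) + 0 ≤ 𝟙 (u b <ᵇ u a ∧ W (a , b)) + 𝟙 (W (a , b))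
      corner≤ = ℕP.≤-trans (ℕP.≤-reflexive (ℕP.+-identityʳ _))
                  (ℕP.≤-trans (𝟙-∧-≤ (u a <ᵇ u b) _) (ℕP.m≤n+m _ _))
      rows≤ : ∀ {q} (r : Region a b q) → rowPair a<b W r (u q) (u b) (u a) ≤ rowPair a<b W r (u q) (u a) (u b)
      rows≤ (before _) = z≤n
      rows≤ {q} (between a<q q<b) =
        𝟙-∧-mono (W (a , q)) (<ᵇ-lift {i = u q} {u b} {u q} {u a} (no-middle⁻ a<q q<b))
      rows≤ {q} (after b<q) =
        𝟙-∧-cross {x = u q <ᵇ u a} {u q <ᵇ u b}
          (<ᵇ-lift {i = u q} {u a} {u q} {u b} (λ uq<ua → <-trans uq<ua ua<ub)) (W-right b<q)
      cols≤ : ∀ {p} (r : Region a b p) → colPair a<b W r (u p) (u b) (u a) ≤ colPair a<b W r (u p) (u a) (u b)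
      cols≤ {p} (before p<a) = subst₂ _≤_ (ℕP.+-comm (𝟙 (u a <ᵇ u p ∧ W (p , b))) _) (ℕP.+-comm (𝟙 (u b <ᵇ u p ∧ W (p , b))) _)
        (𝟙-∧-cross {x = u b <ᵇ u p} {u a <ᵇ u p} (<ᵇ-lift {i = u b} {u p} {u a} {u p} (<-trans ua<ub)) (W-left p<a))
      cols≤ {p} (between a<p p<b) =
        𝟙-∧-mono (W (p , b)) (<ᵇ-lift {i = u a} {u p} {u b} {u p} (no-middle⁺ a<p p<b))
      cols≤ (after _) = z≤n

  module _ {α β : Fin n} (β≡1+α : toℕ β ≡ suc (toℕ α)) where

    private
      α<β : α < β
      α<β = ℕP.≤-reflexive (sym β≡1+α)

    <ᵇ-adjacentˡ : ∀ {c} → c ≢ α → c <ᵇ β ≡ c <ᵇ α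
    <ᵇ-adjacentˡ {c} c≢α = does-⇔ (mk⇔ c<β⇒c<α (λ c<α → <-trans c<α α<β)) (c <? β) (c <? α)
      where
      c<β⇒c<α : c < β → c < α
      c<β⇒c<α c<β = ≤∧≢⇒< (ℕP.≤-pred (subst (suc (toℕ c) ≤_) β≡1+α c<β)) c≢α

    <ᵇ-adjacentʳ : ∀ {c} → c ≢ β → β <ᵇ c ≡ α <ᵇ c
    <ᵇ-adjacentʳ {c} c≢β = does-⇔ (mk⇔ (<-trans α<β) α<c⇒β<c) (β <? c) (α <? c)
      where
      α<c⇒β<c : α < c → β < c
      α<c⇒β<c α<c = ≤∧≢⇒< (subst (_≤ toℕ c) (sym β≡1+α) α<c) (c≢β ∘ sym)

  invCount-swap-adjacent : ∀ W (u : Perm n) → Injective _≡_ _≡_ u → ∀ {a b} (a<b : a < b) →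
    toℕ (u b) ≡ suc (toℕ (u a)) → invCount W (swapPos u a b) ≡ invCount W u + 𝟙 (W (a , b))
  invCount-swap-adjacent W u u-inj {a} {b} a<b adjacent = invCount-swap-≡ corner≡ rows≡ cols≡
    where
    open SwapAt W u a<b
    ua<ub : u a < u b
    ua<ub = ℕP.≤-reflexive (sym adjacent)
    value-≢ : ∀ {i} (r : Region a b i) → u i ≢ u a × u i ≢ u b
    value-≢ r = (proj₁ (region-≢ a<b r) ∘ u-inj) , (proj₂ (region-≢ a<b r) ∘ u-inj)
    corner≡ : 𝟙 (u a <ᵇ u b ∧ W (a , b)) ≡ 𝟙 (u b <ᵇ u a ∧ W (a , b)) + 𝟙 (W (a , b))
    corner≡ rewrite <ᵇ-true ua<ub | <ᵇ-false (<-asym ua<ub) = refl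
    rows≡ : ∀ {q} (r : Region a b q) → rowPair a<b W r (u q) (u b) (u a) ≡ rowPair a<b W r (u q) (u a) (u b)
    rows≡ (before _) = refl
    rows≡ {q} r@(between _ _) = cong (λ z → 𝟙 (z ∧ W (a , q))) (<ᵇ-adjacentˡ adjacent (proj₁ (value-≢ r)))
    rows≡ {q} r@(after _) = cong₂ _+_
      (cong (λ z → 𝟙 (z ∧ W (a , q))) (<ᵇ-adjacentˡ adjacent (proj₁ (value-≢ r))))
      (cong (λ z → 𝟙 (z ∧ W (b , q))) (sym (<ᵇ-adjacentˡ adjacent (proj₁ (value-≢ r)))))
    cols≡ : ∀ {p} (r : Region a b p) → colPair a<b W r (u p) (u b) (u a) ≡ colPair a<b W r (u p) (u a) (u b)
    cols≡ {p} r@(before _) = cong₂ _+_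
      (cong (λ z → 𝟙 (z ∧ W (p , a))) (<ᵇ-adjacentʳ adjacent (proj₂ (value-≢ r))))
      (cong (λ z → 𝟙 (z ∧ W (p , b))) (sym (<ᵇ-adjacentʳ adjacent (proj₂ (value-≢ r)))))
    cols≡ {p} r@(between _ _) = cong (λ z → 𝟙 (z ∧ W (p , b))) (sym (<ᵇ-adjacentʳ adjacent (proj₂ (value-≢ r))))
    cols≡ (after _) = refl

module CanonicalChain where

  open import Data.Bool using (Bool; true; T)
  open import Data.Bool.Properties using (T-∧)
  open import Data.Nat as ℕ using (ℕ; zero; suc; _+_; _∸_; _≤_)
  import Data.Nat.Properties as ℕP
  open import Data.Fin as Fin using (Fin; toℕ; _<_; _≟_; fromℕ<)
  open import Data.Fin.Properties using (<-trans; <-asym; <-cmp; <⇒≢; any?; toℕ<n; toℕ-fromℕ<; injective⇒≤; punchOut-injective)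
  open import Data.Fin.Induction using (<-wellFounded)
  open import Induction.WellFounded using (Acc; acc)
  open import Data.Product using (_×_; _,_; proj₁; proj₂; ∃; ∃₂)
  open import Data.List as List using (List; []; _∷_; _++_; [_]; tabulate; allFin; cartesianProduct)
  open import Data.List.Properties using (length-filter)
  open import Data.List.Membership.Propositional using (_∈_)
  open import Data.List.Membership.Propositional.Properties using (∈-filter⁺; ∈-filter⁻; ∈-cartesianProduct⁺; ∈-allFin)
  open import Data.List.Relation.Unary.Any using (here)
  open import Relation.Binary using (tri<; tri≈; tri>)
  open import Relation.Binary.PropositionalEquality hiding ([_])
  open import Relation.Nullary using (yes; no; contradiction)
  open import Relation.Nullary.Decidable using (T?)
  open import Function using (_∘_; _⇔_; mk⇔; Equivalence)
  open import Function.Definitions using (Injective)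
  open Counting
  open Inversions
  open Covers

  private variable
    n : ℕ

  allᵇ-tabulate : ∀ {A : Set} (p : A → Bool) (f : Fin n → A) → T (allᵇ p (tabulate f)) ⇔ (∀ i → T (p (f i)))
  allᵇ-tabulate {zero}  p f = mk⇔ (λ _ ()) (λ _ → _)
  allᵇ-tabulate {suc n} p f = mk⇔
    (λ t → let (head , tail) = Equivalence.to T-∧ t in
           λ { Fin.zero → head ; (Fin.suc i) → Equivalence.to (allᵇ-tabulate p (f ∘ Fin.suc)) tail i })
    (λ all → Equivalence.from T-∧ (all Fin.zero , Equivalence.from (allᵇ-tabulate p (f ∘ Fin.suc)) (all ∘ Fin.suc)))

  eqPᵇ⇔≗ : ∀ (u w : Perm n) → T (eqPᵇ u w) ⇔ (∀ i → u i ≡ w i)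
  eqPᵇ⇔≗ u w = mk⇔
    (λ t i → does⇒ (u i ≟ w i) (Equivalence.to (allᵇ-tabulate _ (λ i → i)) t i))
    (λ u≗w → Equivalence.from (allᵇ-tabulate _ (λ i → i)) (λ i → T-does (u i ≟ w i) (u≗w i)))

  injective⇒surjective : ∀ {w : Perm n} → Injective _≡_ _≡_ w → ∀ v → ∃ λ i → w i ≡ v
  injective⇒surjective {zero}          _     ()
  injective⇒surjective {suc m} {w} w-inj v with any? (λ i → w i ≟ v)
  ... | yes found = found
  ... | no ¬found = contradiction (injective⇒≤ skipping-v-injective) ℕP.1+n≰n
    where
    v≢w : ∀ i → v ≢ w i
    v≢w i v≡wi = ¬found (i , sym v≡wi)
    skipping-v : Fin (suc m) → Fin m
    skipping-v i = Fin.punchOut (v≢w i)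
    skipping-v-injective : Injective _≡_ _≡_ skipping-v
    skipping-v-injective {i} {j} eq = w-inj (punchOut-injective (v≢w i) (v≢w j) eq)

  increasing⇒identity : ∀ {w : Perm n} → Injective _≡_ _≡_ w → (∀ {p q} → p < q → w p < w q) → ∀ i → w i ≡ i
  increasing⇒identity {w = w} w-inj w-incr i = go i (<-wellFounded i)
    where
    go : ∀ i → Acc _<_ i → w i ≡ i
    go i (acc rec) with <-cmp (w i) i
    ... | tri< wi<i _ _ = contradiction (w-inj (go (w i) (rec wi<i))) (<⇒≢ wi<i)
    ... | tri≈ _ wi≡i _ = wi≡i
    ... | tri> _ _ i<wi with injective⇒surjective w-inj i
    ...   | j , wj≡i with <-cmp j i
    ...     | tri< j<i _ _ = contradiction (trans (sym (go j (rec j<i))) wj≡i) (<⇒≢ j<i)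
    ...     | tri≈ _ j≡i _ = contradiction (sym (trans (cong w (sym j≡i)) wj≡i)) (<⇒≢ i<wi)
    ...     | tri> _ _ i<j = contradiction (w-incr i<j) (<-asym (subst (_< w i) (sym wj≡i) i<wi))

  ∈-Inv⁺ : ∀ (w : Perm n) {p q} → p < q → w q < w p → (p , q) ∈ Inv w
  ∈-Inv⁺ w {p} {q} p<q wq<wp =
    ∈-filter⁺ (T? ∘ λ e → w (proj₂ e) <ᵇ w (proj₁ e))
      (∈-filter⁺ (T? ∘ λ e → proj₁ e <ᵇ proj₂ e) (∈-cartesianProduct⁺ (∈-allFin p) (∈-allFin q)) (<⇒<ᵇ p<q))
      (<⇒<ᵇ {i = w q} {w p} wq<wp)

  ∈-Inv⁻ : ∀ (w : Perm n) {p q} → (p , q) ∈ Inv w → p < q × w q < w p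
  ∈-Inv⁻ {n} w {p} {q} x∈ with ∈-filter⁻ (T? ∘ λ e → w (proj₂ e) <ᵇ w (proj₁ e)) {xs = pairs n} x∈
  ... | x∈pairs , wq<wp =
    <ᵇ⇒< (proj₂ (∈-filter⁻ (T? ∘ λ e → proj₁ e <ᵇ proj₂ e) {xs = cartesianProduct (allFin n) (allFin n)} x∈pairs)) ,
    <ᵇ⇒< {i = w q} {w p} wq<wp

  module _ {w : Perm n} (w-inj : Injective _≡_ _≡_ w) where

    len≡0⇒identity : len w ≡ 0 → ∀ i → w i ≡ i
    len≡0⇒identity len≡0 = increasing⇒identity w-inj increasing
      where
      increasing : ∀ {p q} → p < q → w p < w q
      increasing {p} {q} p<q with <-cmp (w p) (w q)
      ... | tri< wp<wq _ _ = wp<wq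
      ... | tri≈ _ wp≡wq _ = contradiction (w-inj wp≡wq) (<⇒≢ p<q)
      ... | tri> _ _ wq<wp with Inv w | ∈-Inv⁺ w p<q wq<wp
      ...   | _ ∷ _ | _ = contradiction len≡0 λ ()

    -- Shrink the value gap of an inversion (p , q) through the position of the value w q + 1.
    adjacentDescent : len w ≢ 0 → ∃₂ λ a b → a < b × toℕ (w a) ≡ suc (toℕ (w b))
    adjacentDescent len≢0 with Inv w in eq
    ... | []          = contradiction refl len≢0
    ... | (p , q) ∷ _ = let (p<q , wq<wp) = ∈-Inv⁻ w (subst ((p , q) ∈_) (sym eq) (here refl))
                        in shrink (toℕ (w p) ∸ suc (toℕ (w q))) p<q (sym (ℕP.m∸n+n≡m wq<wp))
      where
      shrink : ∀ d {p q} → p < q → toℕ (w p) ≡ d + suc (toℕ (w q)) →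
               ∃₂ λ a b → a < b × toℕ (w a) ≡ suc (toℕ (w b))
      shrink zero    {p} {q} p<q gap = p , q , p<q , gap
      shrink (suc d) {p} {q} p<q gap with injective⇒surjective w-inj (fromℕ< 1+wq<n)
        where
        1+wq<n : suc (toℕ (w q)) ℕ.< n
        1+wq<n = ℕP.≤-<-trans (ℕP.m≤n+m (suc (toℕ (w q))) (suc d)) (subst (ℕ._< n) gap (toℕ<n (w p)))
      ... | r , wr≡1+wq with trans (cong toℕ wr≡1+wq) (toℕ-fromℕ< _)
      ...   | toℕwr≡1+wq with <-cmp r q
      ...     | tri< r<q _ _ = r , q , r<q , toℕwr≡1+wq
      ...     | tri≈ _ refl _ = contradiction toℕwr≡1+wq (ℕP.<⇒≢ (ℕP.n<1+n _))
      ...     | tri> _ _ q<r = shrink d (<-trans p<q q<r)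
                                 (trans gap (trans (sym (ℕP.+-suc d _)) (cong (d +_) (cong suc (sym toℕwr≡1+wq)))))

  isSatChain-++ : ∀ (C : List (Fin n × Fin n)) {x m y} D → T (isSatChainᵇ x m C) →
    (∀ x′ → (∀ i → x′ i ≡ m i) → T (isSatChainᵇ x′ y D)) → T (isSatChainᵇ x y (C ++ D))
  isSatChain-++ []            D sat continue = continue _ (Equivalence.to (eqPᵇ⇔≗ _ _) sat)
  isSatChain-++ ((a , b) ∷ C) D sat continue =
    let (covers , rest) = Equivalence.to T-∧ sat in Equivalence.from T-∧ (covers , isSatChain-++ C D rest continue)

  canonicalChain : ∀ {w : Perm n} → Injective _≡_ _≡_ w →
    ∃ λ C → T (isSatChainᵇ idP w C) × (∀ W → count W C ≡ invCount W w)
  canonicalChain {n} {w} w-inj = build (len w) w w-inj refl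
    where
    build : ∀ k (w : Perm n) → Injective _≡_ _≡_ w → len w ≡ k →
            ∃ λ C → T (isSatChainᵇ idP w C) × (∀ W → count W C ≡ invCount W w)
    build zero w w-inj len≡0 =
      [] , Equivalence.from (eqPᵇ⇔≗ idP w) (sym ∘ len≡0⇒identity w-inj len≡0) ,
      λ W → sym (ℕP.n≤0⇒n≡0 (subst (invCount W w ≤_) len≡0 (length-filter (T? ∘ W) (Inv w))))
    build (suc k) w w-inj len≡1+k with adjacentDescent w-inj (λ len≡0 → ℕP.0≢1+n (trans (sym len≡0) len≡1+k))
    ... | a , b , a<b , wa≡1+wb = C ++ [ (a , b) ] , isSatChain-++ C [ (a , b) ] C-saturated last , counts
      where
      a≢b = <⇒≢ a<b
      u = swapPos w a b
      uab≗w : ∀ i → swapPos u a b i ≡ w i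
      uab≗w = swapPos-involutive w a≢b
      adjacent : toℕ (u b) ≡ suc (toℕ (u a))
      adjacent = trans (cong toℕ (swapPos-b w a≢b)) (trans wa≡1+wb (cong (suc ∘ toℕ) (sym (swapPos-a w a b))))
      step : ∀ W → invCount W w ≡ invCount W u + 𝟙 (W (a , b))
      step W = trans (invCount-cong W (sym ∘ uab≗w))
                     (invCount-swap-adjacent W u (swapPos-injective a≢b w-inj) a<b adjacent)
      len-w : len w ≡ suc (len u)
      len-w = trans (len≡invCount w) (trans (step (λ _ → true)) (trans (ℕP.+-comm _ 1) (cong suc (sym (len≡invCount u)))))
      IH = build k u (swapPos-injective a≢b w-inj) (ℕP.suc-injective (trans (sym len-w) len≡1+k))
      C = proj₁ IH
      C-saturated = proj₁ (proj₂ IH)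
      last : ∀ x → (∀ i → x i ≡ u i) → T (isSatChainᵇ x w [ (a , b) ])
      last x x≗u = Equivalence.from T-∧ (Equivalence.from T-∧ (<⇒<ᵇ a<b , T-does (_ ℕ.≟ _) len-x-step) , ends-at-w)
        where
        ends-at-w : T (eqPᵇ (swapPos x a b) w)
        ends-at-w = Equivalence.from (eqPᵇ⇔≗ _ w) (λ i → trans (swapPos-cong a b x≗u i) (uab≗w i))
        len-x-step : len (swapPos x a b) ≡ suc (len x)
        len-x-step = trans (len-cong (λ i → trans (swapPos-cong a b x≗u i) (uab≗w i)))
                           (trans len-w (cong suc (len-cong (sym ∘ x≗u))))
      counts : ∀ W → count W (C ++ [ (a , b) ]) ≡ invCount W w
      counts W = begin
        count W (C ++ [ (a , b) ])         ≡⟨ count-++ W C [ (a , b) ] ⟩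
        count W C + count W [ (a , b) ]    ≡⟨ cong₂ _+_ (proj₂ (proj₂ IH) W) (count-singleton W (a , b)) ⟩
        invCount W u + 𝟙 (W (a , b))       ≡⟨ step W ⟨
        invCount W w                       ∎
        where open ≡-Reasoning

module ChainMonomials where

  open import Data.Bool using (Bool; true; false; T; _∧_; if_then_else_)
  open import Data.Bool.Properties using (T-∧)
  open import Data.Nat as ℕ using (ℕ; suc; _+_; _≤_)
  import Data.Nat.Properties as ℕP
  import Algebra.Properties.CommutativeSemigroup ℕP.+-commutativeSemigroup as ℕ+
  open import Data.Nat.ListAction using (sum)
  open import Data.Fin as Fin using (Fin; toℕ; _<_; _≤?_; _≟_)
  open import Data.Fin.Properties using (<⇒≢)
  open import Data.Fin.Subset using (Subset; ⊤)
  open import Data.Product using (_×_; _,_; ∃; ∃₂)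
  open import Data.List as List using (List; []; _∷_; _++_; map; filterᵇ; allFin)
  open import Data.List.Membership.Propositional using (_∈_; find; lose)
  open import Data.List.Membership.Propositional.Properties
    using (∈-map⁻; ∈-concatMap⁻; ∈-filter⁻; ∈-map⁺; ∈-concatMap⁺; ∈-filter⁺; ∈-allFin)
  open import Data.List.Relation.Unary.Any using (here)
  open import Data.Vec as Vec using (Vec; lookup; replicate; zipWith)
  import Data.Vec.Properties as VecP
  open import Relation.Binary.PropositionalEquality
  open import Relation.Nullary using (does; yes; no)
  open import Relation.Nullary.Decidable using (dec-true; dec-false; T?)
  open import Function using (_∘_; _⇔_; mk⇔; Equivalence)
  open import Function.Definitions using (Injective)
  open Counting
  open Inversions
  open Covers
  open CanonicalChain

  private variable
    n : ℕ

  _≤ᵇ_ : Fin n → Fin n → Bool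
  i ≤ᵇ j = does (i ≤? j)

  degreeOn : Subset n → Mono n → ℕ
  degreeOn {n} I m = sum (map (lookup m) (filterᵇ (lookup I) (allFin n)))

  degreeOn≡∑ : ∀ (I : Subset n) m → degreeOn I m ≡ ∑ℕ.sum (λ i → if lookup I i then lookup m i else 0)
  degreeOn≡∑ I m = foldr-filterᵇ-tabulate _+_ 0 (λ _ → refl) (lookup I) (lookup m) (λ i → i)

  degreeOn-+ : ∀ (I : Subset n) m₁ m₂ → degreeOn I (zipWith _+_ m₁ m₂) ≡ degreeOn I m₁ + degreeOn I m₂
  degreeOn-+ I m₁ m₂ = begin
    degreeOn I (zipWith _+_ m₁ m₂)
      ≡⟨ degreeOn≡∑ I (zipWith _+_ m₁ m₂) ⟩
    ∑ℕ.sum (λ i → if lookup I i then lookup (zipWith _+_ m₁ m₂) i else 0)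
      ≡⟨ ∑ℕ.sum-cong-≗ pointwise ⟩
    ∑ℕ.sum (λ i → (if lookup I i then lookup m₁ i else 0) + (if lookup I i then lookup m₂ i else 0))
      ≡⟨ ∑ℕ.∑-distrib-+ (λ i → if lookup I i then lookup m₁ i else 0) (λ i → if lookup I i then lookup m₂ i else 0) ⟩
    ∑ℕ.sum (λ i → if lookup I i then lookup m₁ i else 0) + ∑ℕ.sum (λ i → if lookup I i then lookup m₂ i else 0)
      ≡⟨ cong₂ _+_ (degreeOn≡∑ I m₁) (degreeOn≡∑ I m₂) ⟨
    degreeOn I m₁ + degreeOn I m₂ ∎
    where
    open ≡-Reasoning
    pointwise : ∀ i → (if lookup I i then lookup (zipWith _+_ m₁ m₂) i else 0) ≡
                      (if lookup I i then lookup m₁ i else 0) + (if lookup I i then lookup m₂ i else 0)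
    pointwise i rewrite VecP.lookup-zipWith _+_ i m₁ m₂ with lookup I i
    ... | true  = refl
    ... | false = refl

  degreeOn-0 : ∀ (I : Subset n) → degreeOn I (replicate n 0) ≡ 0
  degreeOn-0 {n} I = trans (degreeOn≡∑ I (replicate n 0)) (trans (∑ℕ.sum-cong-≗ pointwise) (∑ℕ.sum-replicate-zero n))
    where
    pointwise : ∀ i → (if lookup I i then lookup (replicate n 0) i else 0) ≡ 0
    pointwise i rewrite VecP.lookup-replicate i 0 with lookup I i
    ... | true  = refl
    ... | false = refl

  degreeOn-unit : ∀ (I : Subset n) c → degreeOn I (unitMono c) ≡ 𝟙 (lookup I c)
  degreeOn-unit {n} I c = begin
    degreeOn I (unitMono c)                                      ≡⟨ degreeOn≡∑ I (unitMono c) ⟩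
    ∑ℕ.sum (λ i → if lookup I i then lookup (unitMono c) i else 0) ≡⟨ sum-without _ c ⟩
    _ + ∑ℕ.sum (without c _)
      ≡⟨ cong₂ _+_ at-c (trans (∑ℕ.sum-cong-≗ elsewhere) (∑ℕ.sum-replicate-zero n)) ⟩
    𝟙 (lookup I c) + 0                                           ≡⟨ ℕP.+-identityʳ _ ⟩
    𝟙 (lookup I c)                                               ∎
    where
    open ≡-Reasoning
    unit-at : ∀ i → lookup (unitMono c) i ≡ (if does (i ≟ c) then 1 else 0)
    unit-at i = VecP.lookup∘tabulate _ i
    at-c : (if lookup I c then lookup (unitMono c) c else 0) ≡ 𝟙 (lookup I c)
    at-c rewrite unit-at c | dec-true (c ≟ c) refl with lookup I c
    ... | true  = refl
    ... | false = refl
    elsewhere : ∀ i → without c (λ i → if lookup I i then lookup (unitMono c) i else 0) i ≡ 0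
    elsewhere i with i ≟ c
    ... | yes _  = refl
    ... | no i≢c rewrite unit-at i | dec-false (i ≟ c) i≢c with lookup I i
    ...   | true  = refl
    ...   | false = refl

  module _ (I : Subset n) where

    containsInterval⇔ : ∀ a b → T (containsIntervalᵇ I (a , b)) ⇔ (∀ i → a Fin.≤ i → i < b → T (lookup I i))
    containsInterval⇔ a b = mk⇔
      (λ t i a≤i i<b → Equivalence.to (T-implication _ _ _) (Equivalence.to (allᵇ-tabulate _ (λ i → i)) t i)
                         (ℕP.≤⇒≤ᵇ a≤i) (<⇒<ᵇ i<b))
      (λ inside → Equivalence.from (allᵇ-tabulate _ (λ i → i)) λ i → Equivalence.from (T-implication _ _ _)
                    λ a≤ᵇi i<ᵇb → inside i (ℕP.≤ᵇ⇒≤ (toℕ a) (toℕ i) a≤ᵇi) (<ᵇ⇒< i<ᵇb))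

    containsInterval-⊆ : ∀ {a b a′ b′} → a Fin.≤ a′ → toℕ b′ ≤ toℕ b →
      T (containsIntervalᵇ I (a , b)) → T (containsIntervalᵇ I (a′ , b′))
    containsInterval-⊆ {a} {b} {a′} {b′} a≤a′ b′≤b t = Equivalence.from (containsInterval⇔ a′ b′)
      λ i a′≤i i<b′ → Equivalence.to (containsInterval⇔ a b) t i (ℕP.≤-trans a≤a′ a′≤i) (ℕP.<-≤-trans i<b′ b′≤b)

  ∈-*P⁻ : ∀ (p q : Poly n) {m} → m ∈ (p *P q) → ∃₂ λ m₁ m₂ → m₁ ∈ p × m₂ ∈ q × m ≡ zipWith _+_ m₁ m₂
  ∈-*P⁻ p q m∈ with find (∈-concatMap⁻ (λ m₁ → map (zipWith _+_ m₁) q) {xs = p} m∈)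
  ... | m₁ , m₁∈ , m∈m₁q with ∈-map⁻ (zipWith _+_ m₁) m∈m₁q
  ...   | m₂ , m₂∈ , m≡ = m₁ , m₂ , m₁∈ , m₂∈ , m≡

  ∈-edgeWeight⁻ : ∀ {a b : Fin n} {m} → m ∈ edgeWeight (a , b) → ∃ λ c → a Fin.≤ c × c < b × m ≡ unitMono c
  ∈-edgeWeight⁻ {n} {a} {b} m∈ with ∈-map⁻ unitMono m∈
  ... | c , c∈ , m≡ with ∈-filter⁻ (T? ∘ λ i → a ≤ᵇ i ∧ i <ᵇ b) {xs = allFin n} c∈
  ...   | _ , in-edge = let (a≤c , c<b) = Equivalence.to T-∧ in-edge
                        in c , ℕP.≤ᵇ⇒≤ (toℕ a) (toℕ c) a≤c , <ᵇ⇒< c<b , m≡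

  data Choice {n} : List (Fin n × Fin n) → Mono n → Set where
    []     : Choice [] (replicate n 0)
    choose : ∀ {a b c J m} → a Fin.≤ c → c Fin.< b → Choice J m → Choice ((a , b) ∷ J) (zipWith _+_ (unitMono c) m)

  ∈-edgeWeight⁺ : ∀ {a b c : Fin n} → a Fin.≤ c → c Fin.< b → unitMono c ∈ edgeWeight (a , b)
  ∈-edgeWeight⁺ {a = a} {b} {c} a≤c c<b = ∈-map⁺ unitMono
    (∈-filter⁺ (T? ∘ λ i → a ≤ᵇ i ∧ i <ᵇ b) (∈-allFin c) (Equivalence.from T-∧ (ℕP.≤⇒≤ᵇ a≤c , <⇒<ᵇ c<b)))

  ∈-*P⁺ : ∀ (p q : Poly n) {m₁ m₂} → m₁ ∈ p → m₂ ∈ q → zipWith _+_ m₁ m₂ ∈ (p *P q)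
  ∈-*P⁺ p q {m₁} m₁∈ m₂∈ = ∈-concatMap⁺ (λ m → map (zipWith _+_ m) q) {xs = p} (lose m₁∈ (∈-map⁺ (zipWith _+_ m₁) m₂∈))

  Choice⇒∈chainWeight : ∀ {J : List (Fin n × Fin n)} {m} → Choice J m → m ∈ chainWeight J
  Choice⇒∈chainWeight []                                   = here refl
  Choice⇒∈chainWeight (choose {a} {b} {J = J} a≤c c<b ch) =
    ∈-*P⁺ (edgeWeight (a , b)) (chainWeight J) (∈-edgeWeight⁺ a≤c c<b) (Choice⇒∈chainWeight ch)

  zipWith-+-left-comm : ∀ {k} (x y z : Vec ℕ k) → zipWith _+_ x (zipWith _+_ y z) ≡ zipWith _+_ y (zipWith _+_ x z)
  zipWith-+-left-comm Vec.[]       Vec.[]       Vec.[]       = refl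
  zipWith-+-left-comm (x Vec.∷ xs) (y Vec.∷ ys) (z Vec.∷ zs) = cong₂ Vec._∷_ (ℕ+.x∙yz≈y∙xz x y z) (zipWith-+-left-comm xs ys zs)

  Choice-insert : ∀ (L₁ L₂ : List (Fin n × Fin n)) {a b c m} → a Fin.≤ c → c Fin.< b →
    Choice (L₁ ++ L₂) m → Choice (L₁ ++ (a , b) ∷ L₂) (zipWith _+_ (unitMono c) m)
  Choice-insert []       L₂ a≤c c<b ch = choose a≤c c<b ch
  Choice-insert (e ∷ L₁) L₂ {c = c} a≤c c<b (choose {c = c′} {m = m′} a′≤c′ c′<b′ ch) =
    subst (Choice (e ∷ L₁ ++ _ ∷ L₂)) (zipWith-+-left-comm (unitMono c′) (unitMono c) m′)
          (choose a′≤c′ c′<b′ (Choice-insert L₁ L₂ a≤c c<b ch))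

  cover⁻ : ∀ (u : Perm n) {a b} → T (coverᵇ u (a , b)) → a < b × len (swapPos u a b) ≡ suc (len u)
  cover⁻ u {a} {b} t = let (a<ᵇb , len-step) = Equivalence.to T-∧ t
                       in <ᵇ⇒< a<ᵇb , does⇒ (len (swapPos u a b) ℕ.≟ suc (len u)) len-step

  invCount-chain-≤ : ∀ (I : Subset n) C {u w : Perm n} → Injective _≡_ _≡_ u → T (isSatChainᵇ u w C) →
    ∀ {m} → m ∈ chainWeight C → invCount (containsIntervalᵇ I) w ≤ invCount (containsIntervalᵇ I) u + degreeOn I m
  invCount-chain-≤ {n} I [] {u} {w} _ u≡w (here refl) = begin
    invCount (containsIntervalᵇ I) w                  ≡⟨ invCount-cong _ (sym ∘ Equivalence.to (eqPᵇ⇔≗ u w) u≡w) ⟩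
    invCount (containsIntervalᵇ I) u                  ≡⟨ ℕP.+-identityʳ _ ⟨
    invCount (containsIntervalᵇ I) u + 0              ≡⟨ cong (invCount (containsIntervalᵇ I) u +_) (degreeOn-0 I) ⟨
    invCount (containsIntervalᵇ I) u + degreeOn I (replicate n 0) ∎
    where open ℕP.≤-Reasoning
  invCount-chain-≤ I ((a , b) ∷ C) {u} {w} u-inj sat m∈
    with Equivalence.to T-∧ sat | ∈-*P⁻ (edgeWeight (a , b)) (chainWeight C) m∈
  ... | covers , rest | m₁ , m₂ , m₁∈ , m₂∈ , refl with ∈-edgeWeight⁻ {a = a} {b} m₁∈ | cover⁻ u covers
  ...   | c , a≤c , c<b , refl | a<b , len-step = begin
    invCount W w                                         ≤⟨ invCount-chain-≤ I C (swapPos-injective (<⇒≢ a<b) u-inj) rest m₂∈ ⟩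
    invCount W (swapPos u a b) + degreeOn I m₂           ≤⟨ ℕP.+-monoˡ-≤ _ step ⟩
    invCount W u + 𝟙 (lookup I c) + degreeOn I m₂        ≡⟨ ℕP.+-assoc (invCount W u) _ _ ⟩
    invCount W u + (𝟙 (lookup I c) + degreeOn I m₂)      ≡⟨ cong (λ k → invCount W u + (k + degreeOn I m₂)) (degreeOn-unit I c) ⟨
    invCount W u + (degreeOn I (unitMono c) + degreeOn I m₂) ≡⟨ cong (invCount W u +_) (degreeOn-+ I (unitMono c) m₂) ⟨
    invCount W u + degreeOn I (zipWith _+_ (unitMono c) m₂) ∎
    where
    open ℕP.≤-Reasoning
    W = containsIntervalᵇ I
    step : invCount W (swapPos u a b) ≤ invCount W u + 𝟙 (lookup I c)
    step = ℕP.≤-trans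
      (Cover.invCount-cover u u-inj a<b len-step W
        (λ {p} _ → containsInterval-⊆ I {p} {b} {p} {a} ℕP.≤-refl (ℕP.<⇒≤ a<b))
        (λ {q} _ → containsInterval-⊆ I {a} {q} {b} {q} (ℕP.<⇒≤ a<b) ℕP.≤-refl))
      (ℕP.+-monoʳ-≤ _ (𝟙-mono λ t → Equivalence.to (containsInterval⇔ I a b) t c a≤c c<b))

  degreeOn-⊤-chain : ∀ (C : List (Fin n × Fin n)) {m} → m ∈ chainWeight C → degreeOn ⊤ m ≡ List.length C
  degreeOn-⊤-chain {n} [] (here refl) = degreeOn-0 (⊤ {n})
  degreeOn-⊤-chain {n} ((a , b) ∷ C) m∈ with ∈-*P⁻ (edgeWeight (a , b)) (chainWeight C) m∈
  ... | m₁ , m₂ , m₁∈ , m₂∈ , refl with ∈-edgeWeight⁻ {a = a} {b} m₁∈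
  ...   | c , _ , _ , refl = begin
    degreeOn ⊤ (zipWith _+_ (unitMono c) m₂)      ≡⟨ degreeOn-+ ⊤ (unitMono c) m₂ ⟩
    degreeOn ⊤ (unitMono c) + degreeOn ⊤ m₂       ≡⟨ cong₂ _+_ (trans (degreeOn-unit ⊤ c) (cong 𝟙 (VecP.lookup-replicate c true)))
                                                               (degreeOn-⊤-chain C m₂∈) ⟩
    suc (List.length C)                          ∎
    where open ≡-Reasoning

module Support where

  open import Data.Bool using (T)
  open import Data.Bool.Properties using (T-∧)
  open import Data.Nat as ℕ using (ℕ; zero; suc; _!)
  open import Data.Nat.Properties using (_!≢0)
  open import Data.Fin as Fin using (Fin; _<_; _<?_)
  open import Data.Product using (_×_; _,_; proj₁; proj₂; ∃)
  open import Data.List as List using (List; []; _∷_; map; length)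
  open import Data.List.Properties using (filter-some)
  open import Data.List.Membership.Propositional using (_∈_; find; lose)
  open import Data.List.Membership.Propositional.Properties
    using (∈-map⁺; ∈-map⁻; ∈-concatMap⁺; ∈-concatMap⁻; ∈-filter⁺; ∈-filter⁻; ∈-cartesianProduct⁺; ∈-allFin)
  open import Data.List.Relation.Unary.Any using (here)
  open import Data.List.Relation.Unary.All using (All; []; _∷_)
  open import Data.Vec.Properties using (≡-dec)
  import Data.Integer as ℤ
  open import Data.Rational as ℚ using (ℚ; 0ℚ; _/_)
  import Data.Rational.Properties as ℚP
  open import Relation.Binary.PropositionalEquality
  open import Relation.Nullary using (does)
  open import Relation.Nullary.Decidable using (T?)
  open import Function using (_∘_; Equivalence)
  open Counting
  open Inversions using (<⇒<ᵇ)
  open ChainMonomials using (cover⁻)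

  private variable
    n : ℕ

  seqs-length : ∀ k {C : List (Fin n × Fin n)} → C ∈ seqs n k → length C ≡ k
  seqs-length {n} zero    (here refl) = refl
  seqs-length {n} (suc k) C∈ with find (∈-concatMap⁻ (λ e → map (e ∷_) (seqs n k)) {xs = pairs n} C∈)
  ... | e , _ , C∈eC with ∈-map⁻ (e ∷_) C∈eC
  ...   | C′ , C′∈ , refl = cong suc (seqs-length k C′∈)

  seqs-complete : ∀ (C : List (Fin n × Fin n)) → All (λ e → proj₁ e Fin.< proj₂ e) C → C ∈ seqs n (length C)
  seqs-complete []            []          = here refl
  seqs-complete {n} ((a , b) ∷ C) (a<b ∷ inc) =
    ∈-concatMap⁺ (λ e → map (e ∷_) (seqs n (length C))) {xs = pairs n}
      (lose (pair∈ a<b) (∈-map⁺ ((a , b) ∷_) (seqs-complete C inc)))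
    where
    pair∈ : a Fin.< b → (a , b) ∈ pairs n
    pair∈ a<b = ∈-filter⁺ (T? ∘ λ e → does (proj₁ e Fin.<? proj₂ e)) (∈-cartesianProduct⁺ (∈-allFin a) (∈-allFin b)) (<⇒<ᵇ a<b)

  saturated⇒increasing : ∀ (C : List (Fin n × Fin n)) {u w} → T (isSatChainᵇ u w C) → All (λ e → proj₁ e Fin.< proj₂ e) C
  saturated⇒increasing []            _   = []
  saturated⇒increasing ((a , b) ∷ C) {u} sat =
    let covers , rest = Equivalence.to T-∧ sat in proj₁ (cover⁻ u covers) ∷ saturated⇒increasing C rest

  positive/≢0 : ∀ k d .{{_ : ℕ.NonZero d}} → 0 ℕ.< k → (ℤ.+ k) / d ≢ 0ℚ
  positive/≢0 (suc k) d _ eq =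
    ℚP.<-irrefl refl (subst (0ℚ ℚ.<_) eq (ℚP.positive⁻¹ ((ℤ.+ suc k) / d) {{ℚP.normalize-pos (suc k) d}}))

  chain⇒coeffD≢0 : ∀ (w : Perm n) (C : List (Fin n × Fin n)) → T (isSatChainᵇ idP w C) → length C ≡ len w →
    ∀ {m} → m ∈ chainWeight C → coeffD w m ≢ 0ℚ
  chain⇒coeffD≢0 {n} w C saturated length≡ {m} m∈C =
    positive/≢0 (coeffP (sumChainWeights w) m) (len w !) {{len w !≢0}}
      (filter-some (T? ∘ λ x → does (≡-dec ℕ._≟_ x m)) (lose m∈sum (T-does (≡-dec ℕ._≟_ m m) refl)))
    where
    C∈ : C ∈ satChains w
    C∈ = ∈-filter⁺ (T? ∘ isSatChainᵇ idP w)
           (subst (λ k → C ∈ seqs n k) length≡ (seqs-complete C (saturated⇒increasing C saturated))) saturated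
    m∈sum : m ∈ sumChainWeights w
    m∈sum = ∈-concatMap⁺ chainWeight {xs = satChains w} (lose C∈ m∈C)

  module _ {n} (w : Perm n) {m : Mono n} (coeff≢0 : coeffD w m ≢ 0ℚ) where

    private
      coeffP≢0 : coeffP (sumChainWeights w) m ≢ 0
      coeffP≢0 coeffP≡0 = coeff≢0 (trans (cong (λ k → ((ℤ.+ k) / (len w !)) {{len w !≢0}}) coeffP≡0)
                                       (ℚP.0/n≡0 (len w !) {{len w !≢0}}))

      m∈sum : m ∈ sumChainWeights w
      m∈sum = let m′ , m′∈ , m′≟m = find (count≢0⇒any _ (sumChainWeights w) coeffP≢0)
              in subst (_∈ sumChainWeights w) (does⇒ (≡-dec ℕ._≟_ m′ m) m′≟m) m′∈

    supportingChain : ∃ λ C → T (isSatChainᵇ idP w C) × length C ≡ len w × m ∈ chainWeight C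
    supportingChain =
      let C , C∈ , m∈C      = find (∈-concatMap⁻ chainWeight {xs = satChains w} m∈sum)
          C∈seqs , saturated = ∈-filter⁻ (T? ∘ isSatChainᵇ idP w) {xs = seqs n (len w)} C∈
      in C , saturated , seqs-length (len w) C∈seqs , m∈C

module Rationals where

  open import Data.Nat as ℕ using (ℕ)
  open import Data.Nat.Coprimality using (1-coprimeTo)
  import Data.Nat.Coprimality as Coprimality
  import Data.Integer as ℤ
  import Data.Integer.Properties as ℤP
  open import Data.Rational as ℚ using (ℚ; mkℚ; 0ℚ; 1ℚ; _/_; _+_; _-_; -_; _*_; _≤_; _⊓_)
  import Data.Rational.Properties as ℚP
  import Data.Rational.Unnormalised as ℚᵘ
  import Data.Rational.Unnormalised.Properties as ℚᵘP
  open import Data.Rational.Solver using (module +-*-Solver)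
  open import Data.List as List using (List; []; _∷_; map; _++_; concatMap)
  import Data.List.Properties as ListP
  import Data.Nat.ListAction as ℕL
  open import Data.List.Relation.Unary.All using (All; []; _∷_)
  open import Data.Product using (_×_; proj₁)
  open import Data.Sum using (inj₁; inj₂)
  open import Relation.Binary.PropositionalEquality using (_≡_; refl; sym; cong; cong₂; trans; subst; subst₂)
  open import Function using (_∘_)

  private variable
    A B : Set

  -- The embedding ℕ → ℚ in the shape (+ k) / 1 used by Defs.
  ι : ℕ → ℚ
  ι k = (ℤ.+ k) / 1

  private
    ι≡mkℚ : ∀ k → ι k ≡ mkℚ (ℤ.+ k) 0 (Coprimality.sym (1-coprimeTo k))
    ι≡mkℚ k = ℚP.normalize-coprime (Coprimality.sym (1-coprimeTo k))

  ι-+ : ∀ m n → ι (m ℕ.+ n) ≡ ι m + ι n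
  ι-+ m n = ℚP.toℚᵘ-injective (ℚᵘP.≃-trans (lhs) (ℚᵘP.≃-sym (ℚᵘP.≃-trans (ℚP.toℚᵘ-homo-+ (ι m) (ι n)) rhs)))
    where
    lhs : ℚ.toℚᵘ (ι (m ℕ.+ n)) ℚᵘ.≃ ℚᵘ.mkℚᵘ (ℤ.+ (m ℕ.+ n)) 0
    lhs rewrite ι≡mkℚ (m ℕ.+ n) = ℚᵘP.≃-refl
    rhs : ℚ.toℚᵘ (ι m) ℚᵘ.+ ℚ.toℚᵘ (ι n) ℚᵘ.≃ ℚᵘ.mkℚᵘ (ℤ.+ (m ℕ.+ n)) 0
    rhs rewrite ι≡mkℚ m | ι≡mkℚ n =
      ℚᵘ.*≡* (cong (ℤ._* ℤ.+ 1) (cong₂ ℤ._+_ (ℤP.*-identityʳ (ℤ.+ m)) (ℤP.*-identityʳ (ℤ.+ n))))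

  ι-mono : ∀ {m n} → m ℕ.≤ n → ι m ≤ ι n
  ι-mono {m} {n} m≤n rewrite ι≡mkℚ m | ι≡mkℚ n =
    ℚ.*≤* (subst₂ ℤ._≤_ (sym (ℤP.*-identityʳ (ℤ.+ m))) (sym (ℤP.*-identityʳ (ℤ.+ n))) (ℤ.+≤+ m≤n))

  0≤ι : ∀ k → 0ℚ ≤ ι k
  0≤ι k = ι-mono {0} {k} ℕ.z≤n

  open +-*-Solver using (solve; _:+_; _:-_; _:*_; _:=_)

  sumℚ-mono : ∀ {f g : A → ℚ} xs → All (λ x → f x ≤ g x) xs → sumℚ (map f xs) ≤ sumℚ (map g xs)
  sumℚ-mono []       []         = ℚP.≤-refl
  sumℚ-mono (x ∷ xs) (fx≤gx ∷ h) = ℚP.+-mono-≤ fx≤gx (sumℚ-mono xs h)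

  sumℚ-++ : ∀ xs ys → sumℚ (xs ++ ys) ≡ sumℚ xs + sumℚ ys
  sumℚ-++ []       ys = sym (ℚP.+-identityˡ _)
  sumℚ-++ (x ∷ xs) ys = trans (cong (x +_) (sumℚ-++ xs ys)) (sym (ℚP.+-assoc x _ _))

  sumℚ-+ : ∀ (f g : A → ℚ) xs → sumℚ (map (λ x → f x + g x) xs) ≡ sumℚ (map f xs) + sumℚ (map g xs)
  sumℚ-+ f g []       = refl
  sumℚ-+ f g (x ∷ xs) = trans (cong (f x + g x +_) (sumℚ-+ f g xs)) (interchange (f x) (g x) _ _)
    where
    interchange : ∀ a b c d → (a + b) + (c + d) ≡ (a + c) + (b + d)
    interchange = solve 4 (λ a b c d → (a :+ b) :+ (c :+ d) := (a :+ c) :+ (b :+ d)) refl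

  sumℚ-*ˡ : ∀ c (f : A → ℚ) xs → sumℚ (map (λ x → c * f x) xs) ≡ c * sumℚ (map f xs)
  sumℚ-*ˡ c f []       = sym (ℚP.*-zeroʳ c)
  sumℚ-*ˡ c f (x ∷ xs) = trans (cong (c * f x +_) (sumℚ-*ˡ c f xs)) (sym (ℚP.*-distribˡ-+ c (f x) _))

  sumℚ-*ʳ : ∀ c (f : A → ℚ) xs → sumℚ (map (λ x → f x * c) xs) ≡ sumℚ (map f xs) * c
  sumℚ-*ʳ c f []       = sym (ℚP.*-zeroˡ c)
  sumℚ-*ʳ c f (x ∷ xs) = trans (cong (f x * c +_) (sumℚ-*ʳ c f xs)) (sym (ℚP.*-distribʳ-+ c (f x) _))

  sumℚ-comm : ∀ (g : A → B → ℚ) xs ys →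
    sumℚ (map (λ y → sumℚ (map (λ x → g x y) xs)) ys) ≡ sumℚ (map (λ x → sumℚ (map (g x) ys)) xs)
  sumℚ-comm g xs []       = sym (sumℚ-zero xs)
    where
    sumℚ-zero : ∀ (xs : List A) → sumℚ (map (λ _ → 0ℚ) xs) ≡ 0ℚ
    sumℚ-zero []       = refl
    sumℚ-zero (_ ∷ xs) = trans (ℚP.+-identityˡ _) (sumℚ-zero xs)
  sumℚ-comm g xs (y ∷ ys) = trans (cong (sumℚ (map (λ x → g x y) xs) +_) (sumℚ-comm g xs ys))
    (sym (sumℚ-+ (λ x → g x y) (λ x → sumℚ (map (g x) ys)) xs))

  sumℚ-ι : ∀ (g : A → ℕ) xs → sumℚ (map (ι ∘ g) xs) ≡ ι (ℕL.sum (map g xs))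
  sumℚ-ι g []       = refl
  sumℚ-ι g (x ∷ xs) = trans (cong (ι (g x) +_) (sumℚ-ι g xs)) (sym (ι-+ (g x) _))

  sumℚ-concatMap : ∀ (g : B → ℚ) (F : A → List B) xs →
    sumℚ (map g (concatMap F xs)) ≡ sumℚ (map (λ x → sumℚ (map g (F x))) xs)
  sumℚ-concatMap g F []       = refl
  sumℚ-concatMap g F (x ∷ xs) = trans (cong sumℚ (ListP.map-++ g (F x) (concatMap F xs)))
    (trans (sumℚ-++ (map g (F x)) _) (cong (sumℚ (map g (F x)) +_) (sumℚ-concatMap g F xs)))

  sumℚ-convex : ∀ {C : Set} (cs : List (ℚ × C)) z → sumℚ (map proj₁ cs) ≡ 1ℚ → sumℚ (map (λ c → proj₁ c * z) cs) ≡ z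
  sumℚ-convex cs z ∑λ≡1 = trans (sumℚ-*ʳ z proj₁ cs) (trans (cong (_* z) ∑λ≡1) (ℚP.*-identityˡ z))

  x-y+y≡x : ∀ x y → x - y + y ≡ x
  x-y+y≡x = solve 2 (λ x y → x :- y :+ y := x) refl

  x+y-y≡x : ∀ x y → x + y - y ≡ x
  x+y-y≡x = solve 2 (λ x y → x :+ y :- y := x) refl

  x+[y-x]≡y : ∀ x y → x + (y - x) ≡ y
  x+[y-x]≡y = solve 2 (λ x y → x :+ (y :- x) := y) refl

  +-≤⇒≤-- : ∀ {x y z} → x + z ≤ y → x ≤ y - z
  +-≤⇒≤-- {x} {y} {z} x+z≤y = subst (_≤ y - z) (x+y-y≡x x z) (ℚP.+-monoˡ-≤ (- z) x+z≤y)

  ≤-+⇒-≤ : ∀ {x y z} → x ≤ y + z → x - z ≤ y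
  ≤-+⇒-≤ {x} {y} {z} x≤y+z = subst (x - z ≤_) (x+y-y≡x y z) (ℚP.+-monoˡ-≤ (- z) x≤y+z)

  ≤⇒0≤- : ∀ {x y} → y ≤ x → 0ℚ ≤ x - y
  ≤⇒0≤- {x} {y} y≤x = +-≤⇒≤-- (subst (_≤ x) (sym (ℚP.+-identityˡ y)) y≤x)

  ≤-+-nonNeg : ∀ x {s} → 0ℚ ≤ s → x ≤ x + s
  ≤-+-nonNeg x {s} 0≤s = subst (_≤ x + s) (ℚP.+-identityʳ x) (ℚP.+-monoʳ-≤ x 0≤s)

  cap : ℚ → ℚ
  cap x = x ⊓ 1ℚ

  cap-mono : ∀ {x y} → x ≤ y → cap x ≤ cap y
  cap-mono = ℚP.⊓-monoˡ-≤ 1ℚ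

  cap-increment : ∀ x {s} → 0ℚ ≤ s → cap (x + s) - cap x ≤ s
  cap-increment x {s} 0≤s with ℚP.≤-total (x + s) 1ℚ | ℚP.≤-total x 1ℚ
  ... | inj₁ x+s≤1 | _ rewrite ℚP.p≤q⇒p⊓q≡p x+s≤1 | ℚP.p≤q⇒p⊓q≡p (ℚP.≤-trans (≤-+-nonNeg x 0≤s) x+s≤1) =
    ℚP.≤-reflexive (trans (cong (_- x) (ℚP.+-comm x s)) (x+y-y≡x s x))
  ... | inj₂ 1≤x+s | inj₁ x≤1 rewrite ℚP.p≥q⇒p⊓q≡q 1≤x+s | ℚP.p≤q⇒p⊓q≡p x≤1 =
    ≤-+⇒-≤ (subst (1ℚ ≤_) (ℚP.+-comm x s) 1≤x+s)
  ... | inj₂ 1≤x+s | inj₂ 1≤x rewrite ℚP.p≥q⇒p⊓q≡q 1≤x+s | ℚP.p≥q⇒p⊓q≡q 1≤x =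
    subst (_≤ s) (sym (ℚP.+-inverseʳ 1ℚ)) 0≤s

module NewtonInPermutahedron where

  open import Data.Bool using (true; T)
  open import Data.Nat as ℕ using (ℕ)
  open import Data.Fin.Properties using (<-cmp; <-asym; <-irrefl)
  open import Data.Fin.Subset using (⊤)
  open import Data.Product using (_×_; _,_; proj₁; proj₂)
  open import Data.List as List using (List; map; filterᵇ; allFin)
  open import Data.List.Properties using (map-cong; map-cong-local)
  open import Data.List.Relation.Unary.All as All using (All)
  open import Data.Vec using (lookup)
  open import Data.Vec.Properties using (lookup-replicate)
  open import Data.Rational as ℚ using (ℚ; 0ℚ; _*_; _≤_)
  import Data.Rational.Properties as ℚP
  open import Relation.Binary using (tri<; tri≈; tri>)
  open import Relation.Binary.PropositionalEquality
  open import Function using (_∘_; mk⇔; Equivalence)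
  open import Function.Definitions using (Injective)
  open Counting
  open Inversions
  open ChainMonomials
  open Support using (supportingChain)
  open Rationals

  private variable
    n : ℕ

  invCount-identity : ∀ W → invCount W (idP {n}) ≡ 0
  invCount-identity {n} W = trans (invCount≡∑² W idP)
    (trans (∑ℕ.sum-cong-≗ (λ p → trans (∑ℕ.sum-cong-≗ (no-inversion p)) (∑ℕ.sum-replicate-zero n)))
           (∑ℕ.sum-replicate-zero n))
    where
    no-inversion : ∀ p q → inv𝟙 idP W p q ≡ 0
    no-inversion p q with <-cmp p q
    ... | tri< p<q _ _ rewrite <ᵇ-true p<q | <ᵇ-false (<-asym p<q) = refl
    ... | tri≈ _ refl _ rewrite <ᵇ-false (<-irrefl {x = p} refl) = refl
    ... | tri> _ _ q<p rewrite <ᵇ-false (<-asym q<p) = refl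

  invCount-⊤ : ∀ (w : Perm n) → invCount (containsIntervalᵇ ⊤) w ≡ len w
  invCount-⊤ w = trans (count-cong {p = containsIntervalᵇ ⊤} {q = λ _ → true} {xs = Inv w} (All.tabulate λ {(a , b)} _ →
                   T⇔T⇒≡ (mk⇔ (λ _ → _) λ _ → Equivalence.from (containsInterval⇔ ⊤ a b) λ i _ _ →
                     subst T (sym (lookup-replicate i true)) _)))
                 (count-true (Inv w))

  module _ {n} (w : Perm n) {m : Mono n} (coeff≢0 : coeffD w m ≢ 0ℚ) where

    invCount≤degreeOn : Injective _≡_ _≡_ w → ∀ I → invCount (containsIntervalᵇ I) w ℕ.≤ degreeOn I m
    invCount≤degreeOn w-inj I =
      let C , saturated , _ , m∈C = supportingChain w coeff≢0 in
      subst (λ k → invCount (containsIntervalᵇ I) w ℕ.≤ k ℕ.+ degreeOn I m) (invCount-identity {n} (containsIntervalᵇ I))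
        (invCount-chain-≤ I C (λ eq → eq) saturated m∈C)

    degreeOn-⊤ : degreeOn ⊤ m ≡ len w
    degreeOn-⊤ = let C , _ , length≡ , m∈C = supportingChain w coeff≢0 in trans (degreeOn-⊤-chain C m∈C) length≡

  sumOver-convex : ∀ (t : Pt n) (cs : List (ℚ × Mono n)) →
    (∀ i → sumℚ (map (λ c → proj₁ c * ι (lookup (proj₂ c) i)) cs) ≡ t i) →
    ∀ I → sumOver I t ≡ sumℚ (map (λ c → proj₁ c * ι (degreeOn I (proj₂ c))) cs)
  sumOver-convex {n} t cs t≡ I = begin
    sumℚ (map t L)
      ≡⟨ cong sumℚ (map-cong (sym ∘ t≡) L) ⟩
    sumℚ (map (λ i → sumℚ (map (λ c → proj₁ c * ι (lookup (proj₂ c) i)) cs)) L)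
      ≡⟨ sumℚ-comm (λ c i → proj₁ c * ι (lookup (proj₂ c) i)) cs L ⟩
    sumℚ (map (λ c → sumℚ (map (λ i → proj₁ c * ι (lookup (proj₂ c) i)) L)) cs)
      ≡⟨ cong sumℚ (map-cong (λ c → trans (sumℚ-*ˡ (proj₁ c) (ι ∘ lookup (proj₂ c)) L)
                                     (cong (proj₁ c *_) (sumℚ-ι (lookup (proj₂ c)) L))) cs) ⟩
    sumℚ (map (λ c → proj₁ c * ι (degreeOn I (proj₂ c))) cs) ∎
    where
    open ≡-Reasoning
    L = filterᵇ (lookup I) (allFin n)

  newton⊆permutahedron : ∀ (w : Perm n) → Injective _≡_ _≡_ w → ∀ t → InNewton w t → InGenPerm (zD w) t
  newton⊆permutahedron w w-inj t (cs , support , ∑λ≡1 , t≡) = (λ I _ → lower-bound I) , total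
    where
    open ℚP.≤-Reasoning
    lower-bound : ∀ I → zD w I ≤ sumOver I t
    lower-bound I = begin
      zD w I                                                     ≡⟨ sumℚ-convex cs (zD w I) ∑λ≡1 ⟨
      sumℚ (map (λ c → proj₁ c * zD w I) cs)                     ≤⟨ sumℚ-mono cs (All.map (λ { {c} (0≤λ , coeff≢0) →
                                                                      ℚP.*-monoˡ-≤-nonNeg (proj₁ c) {{ℚ.nonNegative 0≤λ}}
                                                                        (ι-mono (invCount≤degreeOn w coeff≢0 w-inj I)) }) support) ⟩
      sumℚ (map (λ c → proj₁ c * ι (degreeOn I (proj₂ c))) cs)   ≡⟨ sumOver-convex t cs t≡ I ⟨
      sumOver I t                                                ∎
    total : sumOver ⊤ t ≡ zD w ⊤
    total = begin-equality
      sumOver ⊤ t                                                ≡⟨ sumOver-convex t cs t≡ ⊤ ⟩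
      sumℚ (map (λ c → proj₁ c * ι (degreeOn ⊤ (proj₂ c))) cs)   ≡⟨ cong sumℚ (map-cong-local (All.map (λ { {c} (_ , coeff≢0) →
                                                                      cong (λ k → proj₁ c * ι k) (degreeOn-⊤ w coeff≢0) }) support)) ⟩
      sumℚ (map (λ c → proj₁ c * ι (len w)) cs)                  ≡⟨ sumℚ-convex cs (ι (len w)) ∑λ≡1 ⟩
      ι (len w)                                                  ≡⟨ cong ι (invCount-⊤ w) ⟨
      zD w ⊤                                                     ∎

module IntervalSums where

  open import Data.Bool using (Bool; true; false; T; _∧_; if_then_else_)
  open import Data.Nat as ℕ using (ℕ; zero; suc; s≤s)
  import Data.Nat.Properties as ℕP
  open import Data.Fin as Fin using (Fin; toℕ; fromℕ<; _≟_)
  open import Data.Fin.Properties using (toℕ-fromℕ<; toℕ-injective; punchInᵢ≢i)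
  open import Data.Product using (_×_; _,_; proj₁; proj₂)
  open import Data.Sum using (inj₁; inj₂)
  open import Data.Rational as ℚ using (ℚ; 0ℚ; 1ℚ; _+_; _-_; -_; _≤_)
  import Data.Rational.Properties as ℚP
  open import Algebra.Bundles using (Ring)
  import Algebra.Properties.Semiring.Sum as SemiringSum
  open import Relation.Binary.PropositionalEquality
  open import Relation.Nullary using (¬_; does; yes; no; contradiction)
  open import Relation.Nullary.Decidable using (dec-true; dec-false)
  open import Data.Bool.Properties using (T-∧; T-≡)
  open import Function using (_∘_; Equivalence)

  open Rationals

  private variable
    n : ℕ

  module ∑ℚ = SemiringSum (Ring.semiring ℚP.+-*-ring)

  inInterval : ℕ → ℕ → Fin n → Bool
  inInterval l r i = (l ℕ.≤ᵇ toℕ i) ∧ (toℕ i ℕ.<ᵇ r)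

  module _ {l r : ℕ} {i : Fin n} where

    inInterval⁻ : T (inInterval l r i) → l ℕ.≤ toℕ i × toℕ i ℕ.< r
    inInterval⁻ t = let l≤ᵇi , i<ᵇr = Equivalence.to T-∧ t in ℕP.≤ᵇ⇒≤ l (toℕ i) l≤ᵇi , ℕP.<ᵇ⇒< (toℕ i) r i<ᵇr

    inInterval-true : l ℕ.≤ toℕ i → toℕ i ℕ.< r → inInterval l r i ≡ true
    inInterval-true l≤i i<r = Equivalence.to T-≡ (Equivalence.from T-∧ (ℕP.≤⇒≤ᵇ l≤i , ℕP.<⇒<ᵇ i<r))

    inInterval-false : ¬ (l ℕ.≤ toℕ i × toℕ i ℕ.< r) → inInterval l r i ≡ false
    inInterval-false ∉ with inInterval l r i in eq
    ... | true  = contradiction (inInterval⁻ (subst T (sym eq) _)) ∉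
    ... | false = refl

  intervalSum : (Fin n → ℚ) → ℕ → ℕ → ℚ
  intervalSum t l r = ∑ℚ.sum (λ i → if inInterval l r i then t i else 0ℚ)

  module _ {f g : Fin n → ℚ} (l r : ℕ) where

    intervalSum-cong : (∀ i → T (inInterval l r i) → f i ≡ g i) → intervalSum f l r ≡ intervalSum g l r
    intervalSum-cong f≡g = ∑ℚ.sum-cong-≗ pointwise
      where
      pointwise : ∀ i → (if inInterval l r i then f i else 0ℚ) ≡ (if inInterval l r i then g i else 0ℚ)
      pointwise i with inInterval l r i in eq
      ... | true  = f≡g i (subst T (sym eq) _)
      ... | false = refl

    intervalSum-mono : (∀ i → f i ≤ g i) → intervalSum f l r ≤ intervalSum g l r
    intervalSum-mono f≤g = ∑ℚ-mono pointwise
      where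
      ∑ℚ-mono : ∀ {m} {h k : Fin m → ℚ} → (∀ i → h i ≤ k i) → ∑ℚ.sum h ≤ ∑ℚ.sum k
      ∑ℚ-mono {zero}  _   = ℚP.≤-refl
      ∑ℚ-mono {suc m} h≤k = ℚP.+-mono-≤ (h≤k Fin.zero) (∑ℚ-mono (h≤k ∘ Fin.suc))
      pointwise : ∀ i → (if inInterval l r i then f i else 0ℚ) ≤ (if inInterval l r i then g i else 0ℚ)
      pointwise i with inInterval l r i
      ... | true  = f≤g i
      ... | false = ℚP.≤-refl

    intervalSum-+ : intervalSum (λ i → f i + g i) l r ≡ intervalSum f l r + intervalSum g l r
    intervalSum-+ = trans (∑ℚ.sum-cong-≗ pointwise)
                          (∑ℚ.∑-distrib-+ (λ i → if inInterval l r i then f i else 0ℚ) (λ i → if inInterval l r i then g i else 0ℚ))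
      where
      pointwise : ∀ i → (if inInterval l r i then f i + g i else 0ℚ) ≡
                        (if inInterval l r i then f i else 0ℚ) + (if inInterval l r i then g i else 0ℚ)
      pointwise i with inInterval l r i
      ... | true  = refl
      ... | false = sym (ℚP.+-identityˡ 0ℚ)

  intervalSum-zero : ∀ (f : Fin n → ℚ) l r → (∀ i → T (inInterval l r i) → f i ≡ 0ℚ) → intervalSum f l r ≡ 0ℚ
  intervalSum-zero {n} f l r f≡0 =
    trans (intervalSum-cong {g = λ _ → 0ℚ} l r f≡0) (trans (∑ℚ.sum-cong-≗ pointwise) (∑ℚ.sum-replicate-zero n))
    where
    pointwise : ∀ (i : Fin n) → (if inInterval l r i then 0ℚ else 0ℚ) ≡ 0ℚ
    pointwise i with inInterval l r i
    ... | true  = refl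
    ... | false = refl

  intervalSum-nonNeg : ∀ (f : Fin n → ℚ) l r → (∀ i → 0ℚ ≤ f i) → 0ℚ ≤ intervalSum f l r
  intervalSum-nonNeg {n} f l r 0≤f =
    subst (_≤ intervalSum f l r) (intervalSum-zero (λ (_ : Fin n) → 0ℚ) l r (λ _ _ → refl))
          (intervalSum-mono {f = λ _ → 0ℚ} l r 0≤f)

  intervalSum-- : ∀ (f g : Fin n → ℚ) l r → intervalSum (λ i → f i - g i) l r ≡ intervalSum f l r - intervalSum g l r
  intervalSum-- f g l r = begin
    intervalSum (λ i → f i - g i) l r
      ≡⟨ x+y-y≡x (intervalSum (λ i → f i - g i) l r) (intervalSum g l r) ⟨
    intervalSum (λ i → f i - g i) l r + intervalSum g l r - intervalSum g l r
      ≡⟨ cong (_- intervalSum g l r) (intervalSum-+ {f = λ i → f i - g i} {g} l r) ⟨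
    intervalSum (λ i → f i - g i + g i) l r - intervalSum g l r
      ≡⟨ cong (_- intervalSum g l r) (intervalSum-cong l r (λ i _ → x-y+y≡x (f i) (g i))) ⟩
    intervalSum f l r - intervalSum g l r ∎
    where open ≡-Reasoning

  intervalSum-split : ∀ (f : Fin n → ℚ) {l m r} → l ℕ.≤ m → m ℕ.≤ r →
                      intervalSum f l r ≡ intervalSum f l m + intervalSum f m r
  intervalSum-split f {l} {m} {r} l≤m m≤r = trans (∑ℚ.sum-cong-≗ pointwise)
    (∑ℚ.∑-distrib-+ (λ i → if inInterval l m i then f i else 0ℚ) (λ i → if inInterval m r i then f i else 0ℚ))
    where
    pointwise : ∀ i → (if inInterval l r i then f i else 0ℚ) ≡
                      (if inInterval l m i then f i else 0ℚ) + (if inInterval m r i then f i else 0ℚ)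
    pointwise i with toℕ i ℕ.<? l
    ... | yes i<l rewrite inInterval-false {l = l} {r} {i} (λ (l≤i , _) → ℕP.<⇒≱ i<l l≤i)
                        | inInterval-false {l = l} {m} {i} (λ (l≤i , _) → ℕP.<⇒≱ i<l l≤i)
                        | inInterval-false {l = m} {r} {i} (λ (m≤i , _) → ℕP.<⇒≱ (ℕP.<-≤-trans i<l l≤m) m≤i)
                        = sym (ℚP.+-identityˡ 0ℚ)
    ... | no i≮l with toℕ i ℕ.<? m
    ...   | yes i<m rewrite inInterval-true {l = l} {r} {i} (ℕP.≮⇒≥ i≮l) (ℕP.<-≤-trans i<m m≤r)
                          | inInterval-true {l = l} {m} {i} (ℕP.≮⇒≥ i≮l) i<m
                          | inInterval-false {l = m} {r} {i} (λ (m≤i , _) → ℕP.<⇒≱ i<m m≤i)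
                          = sym (ℚP.+-identityʳ (f i))
    ...   | no i≮m with toℕ i ℕ.<? r
    ...     | yes i<r rewrite inInterval-true {l = l} {r} {i} (ℕP.≮⇒≥ i≮l) i<r
                            | inInterval-false {l = l} {m} {i} (λ (_ , i<m) → i≮m i<m)
                            | inInterval-true {l = m} {r} {i} (ℕP.≮⇒≥ i≮m) i<r
                            = sym (ℚP.+-identityˡ (f i))
    ...     | no i≮r rewrite inInterval-false {l = l} {r} {i} (λ (_ , i<r) → i≮r i<r)
                           | inInterval-false {l = l} {m} {i} (λ (_ , i<m) → i≮m i<m)
                           | inInterval-false {l = m} {r} {i} (λ (_ , i<r) → i≮r i<r)
                           = sym (ℚP.+-identityˡ 0ℚ)

  intervalSum-empty : ∀ (f : Fin n → ℚ) l → intervalSum f l l ≡ 0ℚ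
  intervalSum-empty f l = intervalSum-zero f l l λ i t →
    let l≤i , i<l = inInterval⁻ {l = l} {l} {i} t in contradiction l≤i (ℕP.<⇒≱ i<l)

  ∑ℚ-delta : ∀ (f : Fin n → ℚ) i → ∑ℚ.sum (λ j → if does (j ≟ i) then f j else 0ℚ) ≡ f i
  ∑ℚ-delta {suc n} f i = begin
    ∑ℚ.sum g                            ≡⟨ ∑ℚ.sum-remove {i = i} g ⟩
    g i + ∑ℚ.sum (g ∘ Fin.punchIn i)     ≡⟨ cong₂ _+_ at-i (trans (∑ℚ.sum-cong-≗ off-i) (∑ℚ.sum-replicate-zero n)) ⟩
    f i + 0ℚ                            ≡⟨ ℚP.+-identityʳ (f i) ⟩
    f i                                 ∎
    where
    open ≡-Reasoning
    g : Fin (suc n) → ℚ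
    g j = if does (j ≟ i) then f j else 0ℚ
    at-i : g i ≡ f i
    at-i rewrite dec-true (i ≟ i) refl = refl
    off-i : ∀ j → g (Fin.punchIn i j) ≡ 0ℚ
    off-i j rewrite dec-false (Fin.punchIn i j ≟ i) (punchInᵢ≢i i j) = refl

  intervalSum-point : ∀ (f : Fin n → ℚ) i → intervalSum f (toℕ i) (suc (toℕ i)) ≡ f i
  intervalSum-point f i = trans (∑ℚ.sum-cong-≗ pointwise) (∑ℚ-delta f i)
    where
    pointwise : ∀ j → (if inInterval (toℕ i) (suc (toℕ i)) j then f j else 0ℚ) ≡ (if does (j ≟ i) then f j else 0ℚ)
    pointwise j with j ≟ i
    ... | yes refl rewrite inInterval-true {l = toℕ j} {suc (toℕ j)} {j} ℕP.≤-refl ℕP.≤-refl = refl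
    ... | no j≢i rewrite inInterval-false {l = toℕ i} {suc (toℕ i)} {j}
                           (λ (i≤j , j<1+i) → j≢i (toℕ-injective (ℕP.≤-antisym (ℕP.≤-pred j<1+i) i≤j))) = refl

  intervalSum-snoc : ∀ (f : Fin n → ℚ) {l r} i → toℕ i ≡ r → l ℕ.≤ r →
                     intervalSum f l (suc r) ≡ intervalSum f l r + f i
  intervalSum-snoc f {l} i refl l≤i =
    trans (intervalSum-split f l≤i (ℕP.n≤1+n (toℕ i))) (cong (intervalSum f l (toℕ i) +_) (intervalSum-point f i))


  module Peel {n} (t : Fin n → ℚ) (0≤t : ∀ i → 0ℚ ≤ t i) {A B : ℕ} (A≤B : A ℕ.≤ B) (B≤n : B ℕ.≤ n)
              (1≤Σt[A,B] : 1ℚ ≤ intervalSum t A B) where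

    prefix : ℕ → ℚ
    prefix r = intervalSum t A r

    -- The first unit of mass of t on [A , B), taken greedily from the left.
    y : Fin n → ℚ
    y i = if inInterval A B i then cap (prefix (suc (toℕ i))) - cap (prefix (toℕ i)) else 0ℚ

    private
      prefix-snoc : ∀ i → A ℕ.≤ toℕ i → prefix (suc (toℕ i)) ≡ prefix (toℕ i) + t i
      prefix-snoc i A≤i = intervalSum-snoc t i refl A≤i

    0≤y : ∀ i → 0ℚ ≤ y i
    0≤y i with inInterval A B i in eq
    ... | false = ℚP.≤-refl
    ... | true  = ≤⇒0≤- (cap-mono (subst (prefix (toℕ i) ≤_) (sym (prefix-snoc i A≤i)) (≤-+-nonNeg (prefix (toℕ i)) (0≤t i))))
      where A≤i = proj₁ (inInterval⁻ {l = A} {B} {i} (subst T (sym eq) _))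

    y≤t : ∀ i → y i ≤ t i
    y≤t i with inInterval A B i in eq
    ... | false = 0≤t i
    ... | true  = subst (λ p → cap p - cap (prefix (toℕ i)) ≤ t i) (sym (prefix-snoc i A≤i))
                        (cap-increment (prefix (toℕ i)) (0≤t i))
      where A≤i = proj₁ (inInterval⁻ {l = A} {B} {i} (subst T (sym eq) _))

    y-outside : ∀ i → ¬ (A ℕ.≤ toℕ i × toℕ i ℕ.< B) → y i ≡ 0ℚ
    y-outside i ∉ rewrite inInterval-false {l = A} {B} {i} ∉ = refl

    intervalSum-y-prefix : ∀ r → A ℕ.≤ r → r ℕ.≤ B → intervalSum y A r ≡ cap (prefix r)
    intervalSum-y-prefix r A≤r r≤B with ℕP.m≤n⇒m<n∨m≡n A≤r
    ... | inj₂ refl = trans (intervalSum-empty y A) (cong cap (sym (intervalSum-empty t A)))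
    intervalSum-y-prefix (suc r) _ 1+r≤B | inj₁ (s≤s A≤r) = begin
      intervalSum y A (suc r)
        ≡⟨ intervalSum-snoc y i toℕi≡r A≤r ⟩
      intervalSum y A r + y i
        ≡⟨ cong₂ _+_ (intervalSum-y-prefix r A≤r (ℕP.<⇒≤ 1+r≤B)) y-at-i ⟩
      cap (prefix r) + (cap (prefix (suc r)) - cap (prefix r))
        ≡⟨ x+[y-x]≡y (cap (prefix r)) (cap (prefix (suc r))) ⟩
      cap (prefix (suc r)) ∎
      where
      open ≡-Reasoning
      r<n = ℕP.<-≤-trans 1+r≤B B≤n
      i = fromℕ< r<n
      toℕi≡r : toℕ i ≡ r
      toℕi≡r = toℕ-fromℕ< r<n
      y-at-i : y i ≡ cap (prefix (suc r)) - cap (prefix r)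
      y-at-i rewrite inInterval-true {l = A} {B} {i} (subst (A ℕ.≤_) (sym toℕi≡r) A≤r) (subst (ℕ._< B) (sym toℕi≡r) 1+r≤B)
                   | toℕi≡r = refl

    intervalSum-y-before : ∀ l → intervalSum y l A ≡ 0ℚ
    intervalSum-y-before l = intervalSum-zero y l A λ i t →
      y-outside i λ (A≤i , _) → ℕP.<⇒≱ (proj₂ (inInterval⁻ {l = l} {A} {i} t)) A≤i

    intervalSum-y-beyond : ∀ l r → B ℕ.≤ l → intervalSum y l r ≡ 0ℚ
    intervalSum-y-beyond l r B≤l = intervalSum-zero y l r λ i t →
      y-outside i λ (_ , i<B) → ℕP.<⇒≱ i<B (ℕP.≤-trans B≤l (proj₁ (inInterval⁻ {l = l} {r} {i} t)))

    intervalSum-y-⊇ : ∀ l r → l ℕ.≤ A → B ℕ.≤ r → intervalSum y l r ≡ 1ℚ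
    intervalSum-y-⊇ l r l≤A B≤r = begin
      intervalSum y l r
        ≡⟨ intervalSum-split y l≤A (ℕP.≤-trans A≤B B≤r) ⟩
      intervalSum y l A + intervalSum y A r
        ≡⟨ cong₂ _+_ (intervalSum-y-before l) (intervalSum-split y A≤B B≤r) ⟩
      0ℚ + (intervalSum y A B + intervalSum y B r)
        ≡⟨ ℚP.+-identityˡ _ ⟩
      intervalSum y A B + intervalSum y B r
        ≡⟨ cong₂ _+_ (intervalSum-y-prefix B A≤B ℕP.≤-refl) (intervalSum-y-beyond B r ℕP.≤-refl) ⟩
      cap (prefix B) + 0ℚ
        ≡⟨ ℚP.+-identityʳ _ ⟩
      cap (prefix B)
        ≡⟨ ℚP.p≥q⇒p⊓q≡q {prefix B} {1ℚ} 1≤Σt[A,B] ⟩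
      1ℚ ∎
      where open ≡-Reasoning

    intervalSum-y-suffix : ∀ l r → A ℕ.≤ l → l ℕ.≤ B → B ℕ.≤ r → intervalSum y l r ≡ 1ℚ - cap (prefix l)
    intervalSum-y-suffix l r A≤l l≤B B≤r = begin
      intervalSum y l r
        ≡⟨ x+y-y≡x _ (cap (prefix l)) ⟨
      intervalSum y l r + cap (prefix l) - cap (prefix l)
        ≡⟨ cong (_- cap (prefix l)) (ℚP.+-comm (intervalSum y l r) (cap (prefix l))) ⟩
      cap (prefix l) + intervalSum y l r - cap (prefix l)
        ≡⟨ cong (λ p → p + intervalSum y l r - cap (prefix l)) (intervalSum-y-prefix l A≤l l≤B) ⟨
      intervalSum y A l + intervalSum y l r - cap (prefix l)
        ≡⟨ cong (_- cap (prefix l)) (intervalSum-split y A≤l (ℕP.≤-trans l≤B B≤r)) ⟨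
      intervalSum y A r - cap (prefix l)
        ≡⟨ cong (_- cap (prefix l)) (intervalSum-y-⊇ A r ℕP.≤-refl B≤r) ⟩
      1ℚ - cap (prefix l) ∎
      where open ≡-Reasoning

module HallConditions where

  open import Data.Bool using (Bool; true; false; T; _∧_)
  open import Data.Bool.Properties using (T-∧; T-≡)
  open import Data.Nat as ℕ using (ℕ; suc; z≤n)
  import Data.Nat.Properties as ℕP
  open import Data.Fin as Fin using (Fin; toℕ)
  open import Data.Fin.Properties using (toℕ<n)
  open import Data.Product using (_×_; _,_; proj₁; proj₂)
  open import Data.Sum using (_⊎_; inj₁; inj₂)
  open import Data.List as List using (List; _∷_; _++_; length)
  open import Data.List.Relation.Unary.All as All using (All; _∷_)
  open import Data.Rational as ℚ using (ℚ; 0ℚ; 1ℚ; _+_; _-_; _≤_)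
  import Data.Rational.Properties as ℚP
  open import Data.Rational.Solver using (module +-*-Solver)
  open import Relation.Binary.PropositionalEquality hiding (J)
  open import Relation.Nullary using (Dec; yes; no; contradiction)
  open import Function using (Equivalence)
  open Counting using (𝟙; count; count-insert; length-insert; count-mono; count-none)
  open Rationals using (ι; ι-+; ι-mono; 0≤ι; x+y-y≡x; +-≤⇒≤--; ≤⇒0≤-)
  open IntervalSums

  private variable
    n : ℕ

  inside : ℕ → ℕ → Fin n × Fin n → Bool
  inside l r (a , b) = (l ℕ.≤ᵇ toℕ a) ∧ (toℕ b ℕ.≤ᵇ r)

  within : List (Fin n × Fin n) → ℕ → ℕ → ℕ
  within J l r = count (inside l r) J

  Hall : List (Fin n × Fin n) → (Fin n → ℚ) → Set
  Hall J t = ∀ l r → ι (within J l r) ≤ intervalSum t l r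

  within-antimonoˡ : ∀ (J : List (Fin n × Fin n)) {l l′} r → l′ ℕ.≤ l → within J l r ℕ.≤ within J l′ r
  within-antimonoˡ J r l′≤l = count-mono J λ (a , b) t →
    let l≤a , b≤r = Equivalence.to T-∧ t
    in Equivalence.from T-∧ (ℕP.≤⇒≤ᵇ (ℕP.≤-trans l′≤l (ℕP.≤ᵇ⇒≤ _ _ l≤a)) , b≤r)

  within-short : ∀ (J : List (Fin n × Fin n)) {B} l r → All (λ e → B ℕ.≤ toℕ (proj₂ e)) J → r ℕ.< B → within J l r ≡ 0
  within-short J {B} l r ends≥B r<B = count-none (All.map (λ {(a , b)} B≤b inside →
    ℕP.<⇒≱ (ℕP.<-≤-trans r<B B≤b) (ℕP.≤ᵇ⇒≤ (toℕ b) r (proj₂ (Equivalence.to T-∧ inside)))) ends≥B)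

  Hall⇒nonNeg : ∀ J (t : Fin n → ℚ) → Hall J t → ∀ i → 0ℚ ≤ t i
  Hall⇒nonNeg J t hall i = ℚP.≤-trans (0≤ι (within J (toℕ i) (suc (toℕ i))))
    (subst (ι (within J (toℕ i) (suc (toℕ i))) ≤_) (intervalSum-point t i) (hall (toℕ i) (suc (toℕ i))))

  module HallStep (L₁ : List (Fin n × Fin n)) {a b : Fin n} (L₂ : List (Fin n × Fin n)) (a<b : a Fin.< b)
                  (ends≥b : All (λ e → toℕ b ℕ.≤ toℕ (proj₂ e)) (L₁ ++ L₂))
                  (t : Fin n → ℚ) (hall : Hall (L₁ ++ (a , b) ∷ L₂) t) where

    private
      A = toℕ a
      B = toℕ b
      J = L₁ ++ (a , b) ∷ L₂
      J′ = L₁ ++ L₂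

      within-covering : ∀ {l r} → l ℕ.≤ A → B ℕ.≤ r → within J l r ≡ within J′ l r ℕ.+ 1
      within-covering {l} {r} l≤A B≤r = trans (count-insert (inside l r) L₁ (a , b) L₂)
        (cong (λ x → within J′ l r ℕ.+ 𝟙 x) (Equivalence.to T-≡ (Equivalence.from T-∧ (ℕP.≤⇒≤ᵇ l≤A , ℕP.≤⇒≤ᵇ B≤r))))

      within-after : ∀ {l r} → A ℕ.< l → within J l r ≡ within J′ l r
      within-after {l} {r} A<l = trans (count-insert (inside l r) L₁ (a , b) L₂)
        (trans (cong (λ x → within J′ l r ℕ.+ 𝟙 x) not-inside) (ℕP.+-identityʳ _))
        where
        not-inside : inside l r (a , b) ≡ false
        not-inside with inside l r (a , b) in eq
        ... | false = refl
        ... | true  = contradiction (ℕP.≤ᵇ⇒≤ l A (proj₁ (Equivalence.to T-∧ (subst T (sym eq) _)))) (ℕP.<⇒≱ A<l)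

      1≤Σt[A,B] : 1ℚ ≤ intervalSum t A B
      1≤Σt[A,B] = ℚP.≤-trans (ι-mono (subst (1 ℕ.≤_) (sym (within-covering ℕP.≤-refl ℕP.≤-refl)) (ℕP.m≤n+m 1 _))) (hall A B)

    open Peel t (Hall⇒nonNeg J t hall) (ℕP.<⇒≤ a<b) (ℕP.<⇒≤ (toℕ<n b)) 1≤Σt[A,B] public

    t′ : Fin n → ℚ
    t′ i = t i - y i

    private
      ι-suc : ∀ k → ι (k ℕ.+ 1) ≡ ι k + 1ℚ
      ι-suc k = ι-+ k 1

      short : ∀ l r → r ℕ.< B → ι (within J′ l r) ≤ intervalSum t′ l r
      short l r r<B = subst (λ k → ι k ≤ intervalSum t′ l r) (sym (within-short J′ l r ends≥b r<B))
                            (intervalSum-nonNeg t′ l r (λ i → ≤⇒0≤- (y≤t i)))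

      covering : ∀ l r → l ℕ.≤ A → B ℕ.≤ r → ι (within J′ l r) ≤ intervalSum t′ l r
      covering l r l≤A B≤r = subst (ι (within J′ l r) ≤_)
        (sym (trans (intervalSum-- t y l r) (cong (intervalSum t l r -_) (intervalSum-y-⊇ l r l≤A B≤r))))
        (+-≤⇒≤-- {z = 1ℚ} (subst (_≤ intervalSum t l r)
          (trans (cong ι (within-covering l≤A B≤r)) (ι-suc (within J′ l r))) (hall l r)))

      untouched : ∀ l r → A ℕ.< l → intervalSum y l r ≡ 0ℚ → ι (within J′ l r) ≤ intervalSum t′ l r
      untouched l r A<l Σy≡0 = subst₂ (λ k s → ι k ≤ s) (within-after A<l)
        (sym (trans (intervalSum-- t y l r) (trans (cong (intervalSum t l r -_) Σy≡0) (ℚP.+-identityʳ _))))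
        (hall l r)

      partial : ∀ l r → A ℕ.< l → l ℕ.≤ B → B ℕ.≤ r → prefix l ≤ 1ℚ → ι (within J′ l r) ≤ intervalSum t′ l r
      partial l r A<l l≤B B≤r prefix≤1 = subst (ι (within J′ l r) ≤_) (sym Σt′≡) (+-≤⇒≤-- {z = 1ℚ} (begin
        ι (within J′ l r) + 1ℚ            ≤⟨ ℚP.+-monoˡ-≤ 1ℚ (ι-mono (within-antimonoˡ J′ r A≤l)) ⟩
        ι (within J′ A r) + 1ℚ            ≡⟨ trans (sym (ι-suc (within J′ A r))) (cong ι (sym (within-covering ℕP.≤-refl B≤r))) ⟩
        ι (within J A r)                  ≤⟨ hall A r ⟩
        intervalSum t A r                 ≡⟨ intervalSum-split t A≤l (ℕP.≤-trans l≤B B≤r) ⟩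
        prefix l + intervalSum t l r      ∎))
        where
        open ℚP.≤-Reasoning
        open +-*-Solver using (solve; _:+_; _:-_; _:=_; con)
        A≤l = ℕP.<⇒≤ A<l
        rearrange : ∀ p q → p - (1ℚ - q) ≡ q + p - 1ℚ
        rearrange = solve 2 (λ p q → p :- (con 1ℚ :- q) := q :+ p :- con 1ℚ) refl
        Σt′≡ : intervalSum t′ l r ≡ prefix l + intervalSum t l r - 1ℚ
        Σt′≡ = trans (intervalSum-- t y l r) (trans (cong (intervalSum t l r -_)
                 (trans (intervalSum-y-suffix l r A≤l l≤B B≤r) (cong (1ℚ -_) (ℚP.p≤q⇒p⊓q≡p prefix≤1))))
                 (rearrange (intervalSum t l r) (prefix l)))

    hall′ : Hall J′ t′
    hall′ l r = by-cases (r ℕ.<? B) (l ℕ.≤? A) (B ℕ.≤? l) (ℚP.≤-total (prefix l) 1ℚ)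
      where
      by-cases : Dec (r ℕ.< B) → Dec (l ℕ.≤ A) → Dec (B ℕ.≤ l) → prefix l ≤ 1ℚ ⊎ 1ℚ ≤ prefix l →
                 ι (within J′ l r) ≤ intervalSum t′ l r
      by-cases (yes r<B) _ _ _ = short l r r<B
      by-cases (no r≮B) (yes l≤A) _ _ = covering l r l≤A (ℕP.≮⇒≥ r≮B)
      by-cases (no r≮B) (no l≰A) (yes B≤l) _ = untouched l r (ℕP.≰⇒> l≰A) (intervalSum-y-beyond l r B≤l)
      by-cases (no r≮B) (no l≰A) (no B≰l) (inj₁ prefix≤1) =
        partial l r (ℕP.≰⇒> l≰A) (ℕP.<⇒≤ (ℕP.≰⇒> B≰l)) (ℕP.≮⇒≥ r≮B) prefix≤1
      by-cases (no r≮B) (no l≰A) (no B≰l) (inj₂ 1≤prefix) = untouched l r (ℕP.≰⇒> l≰A)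
        (trans (intervalSum-y-suffix l r (ℕP.<⇒≤ (ℕP.≰⇒> l≰A)) (ℕP.<⇒≤ (ℕP.≰⇒> B≰l)) (ℕP.≮⇒≥ r≮B))
               (trans (cong (1ℚ -_) (ℚP.p≥q⇒p⊓q≡q 1≤prefix)) (ℚP.+-inverseʳ 1ℚ)))

    total′ : intervalSum t 0 n ≡ ι (length J) → intervalSum t′ 0 n ≡ ι (length J′)
    total′ Σt≡ = begin
      intervalSum t′ 0 n                           ≡⟨ intervalSum-- t y 0 n ⟩
      intervalSum t 0 n - intervalSum y 0 n        ≡⟨ cong₂ _-_ Σt≡ (intervalSum-y-⊇ 0 n z≤n (ℕP.<⇒≤ (toℕ<n b))) ⟩
      ι (length J) - 1ℚ                            ≡⟨ cong (λ k → ι k - 1ℚ) (trans (length-insert L₁ (a , b) L₂) (ℕP.+-comm 1 _)) ⟩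
      ι (length J′ ℕ.+ 1) - 1ℚ                     ≡⟨ cong (_- 1ℚ) (ι-suc (length J′)) ⟩
      ι (length J′) + 1ℚ - 1ℚ                      ≡⟨ x+y-y≡x (ι (length J′)) 1ℚ ⟩
      ι (length J′)                                ∎
      where open ≡-Reasoning

module MinkowskiSums where

  open import Data.Bool using (true; false; T; if_then_else_)
  open import Data.Nat as ℕ using (ℕ)
  open import Data.Fin as Fin using (Fin; toℕ; _≟_)
  open import Data.Product using (_×_; _,_; proj₁; proj₂; Σ)
  open import Data.List as List using (List; _∷_; _++_; map; filterᵇ; allFin; concatMap)
  open import Data.List.Properties using (map-cong; map-∘)
  open import Data.List.Relation.Unary.All as All using (All; _∷_)
  open import Data.List.Relation.Unary.All.Properties using (concat⁺; map⁺; all-filter)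
  open import Data.Vec as Vec using (lookup; zipWith)
  import Data.Vec.Properties as VecP
  open import Data.Rational as ℚ using (ℚ; 0ℚ; 1ℚ; _+_; _*_; _≤_)
  import Data.Rational.Properties as ℚP
  open import Data.Rational.Solver using (module +-*-Solver)
  open import Relation.Binary.PropositionalEquality
  open import Relation.Nullary using (¬_; does; yes; no; contradiction)
  open import Relation.Nullary.Decidable using (dec-true; dec-false; T?)
  open import Function using (_∘_)
  open Counting using (foldr-filterᵇ-tabulate)
  open ChainMonomials using (Choice; Choice-insert)
  open Rationals
  open IntervalSums

  private variable
    n : ℕ

  -- t is a convex combination of monomials choosing one variable x_c, a ≤ c < b, from every edge
  -- (a , b) of J, i.e. a point of the Minkowski sum of the simplices Δ[a , b).
  InMinkowskiSum : List (Fin n × Fin n) → (Fin n → ℚ) → Set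
  InMinkowskiSum {n} J t = Σ (List (ℚ × Mono n)) λ cs →
      All (λ c → (0ℚ ≤ proj₁ c) × Choice J (proj₂ c)) cs
    × (sumℚ (map proj₁ cs) ≡ 1ℚ)
    × (∀ i → sumℚ (map (λ c → proj₁ c * ι (lookup (proj₂ c) i)) cs) ≡ t i)

  InMinkowskiSum-insert : ∀ (L₁ L₂ : List (Fin n × Fin n)) {a b} (y : Fin n → ℚ) → (∀ i → 0ℚ ≤ y i) →
    (∀ i → ¬ (toℕ a ℕ.≤ toℕ i × toℕ i ℕ.< toℕ b) → y i ≡ 0ℚ) → intervalSum y (toℕ a) (toℕ b) ≡ 1ℚ →
    ∀ {t′} → InMinkowskiSum (L₁ ++ L₂) t′ → InMinkowskiSum (L₁ ++ (a , b) ∷ L₂) (λ i → y i + t′ i)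
  InMinkowskiSum-insert {n} L₁ L₂ {a} {b} y 0≤y y-outside Σy≡1 {t′} (cs′ , valid′ , ∑λ′≡1 , t′≡) =
    cs , valid , ∑λ≡1 , coordinates
    where
    open ≡-Reasoning
    A = toℕ a
    B = toℕ b
    positions : List (Fin n)
    positions = filterᵇ (inInterval A B) (allFin n)
    sum-positions : ∀ g → sumℚ (map g positions) ≡ intervalSum g A B
    sum-positions g = foldr-filterᵇ-tabulate _+_ 0ℚ ℚP.+-identityˡ (inInterval A B) g (λ i → i)
    spread : Fin n → List (ℚ × Mono n)
    spread c = map (λ d → y c * proj₁ d , zipWith ℕ._+_ (unitMono c) (proj₂ d)) cs′
    cs : List (ℚ × Mono n)
    cs = concatMap spread positions

    valid : All (λ c → (0ℚ ≤ proj₁ c) × Choice (L₁ ++ (a , b) ∷ L₂) (proj₂ c)) cs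
    valid = concat⁺ (map⁺ (All.map valid-spread (all-filter (T? ∘ inInterval A B) (allFin n))))
      where
      valid-spread : ∀ {c} → T (inInterval A B c) →
                     All (λ e → (0ℚ ≤ proj₁ e) × Choice (L₁ ++ (a , b) ∷ L₂) (proj₂ e)) (spread c)
      valid-spread {c} c∈ = map⁺ (All.map (λ { {d} (0≤λ , ch) →
          ℚP.nonNegative⁻¹ (y c * proj₁ d)
            {{ℚP.nonNeg*nonNeg⇒nonNeg (y c) {{ℚ.nonNegative (0≤y c)}} (proj₁ d) {{ℚ.nonNegative 0≤λ}}}} ,
          Choice-insert L₁ L₂ (proj₁ (inInterval⁻ {l = A} {B} {c} c∈)) (proj₂ (inInterval⁻ {l = A} {B} {c} c∈)) ch }) valid′)

    weight-spread : ∀ c → sumℚ (map proj₁ (spread c)) ≡ y c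
    weight-spread c = begin
      sumℚ (map proj₁ (spread c))                  ≡⟨ cong sumℚ (map-∘ cs′) ⟨
      sumℚ (map (λ d → y c * proj₁ d) cs′)         ≡⟨ sumℚ-*ˡ (y c) proj₁ cs′ ⟩
      y c * sumℚ (map proj₁ cs′)                   ≡⟨ cong (y c *_) ∑λ′≡1 ⟩
      y c * 1ℚ                                     ≡⟨ ℚP.*-identityʳ (y c) ⟩
      y c                                          ∎

    ∑λ≡1 : sumℚ (map proj₁ cs) ≡ 1ℚ
    ∑λ≡1 = trans (sumℚ-concatMap proj₁ spread positions)
             (trans (cong sumℚ (map-cong weight-spread positions)) (trans (sum-positions y) Σy≡1))

    coordinate-spread : ∀ i c → sumℚ (map (λ e → proj₁ e * ι (lookup (proj₂ e) i)) (spread c)) ≡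
                                y c * ι (lookup (unitMono c) i) + y c * t′ i
    coordinate-spread i c = begin
      sumℚ (map (λ e → proj₁ e * ι (lookup (proj₂ e) i)) (spread c))
        ≡⟨ cong sumℚ (map-∘ cs′) ⟨
      sumℚ (map (λ d → y c * proj₁ d * ι (lookup (zipWith ℕ._+_ (unitMono c) (proj₂ d)) i)) cs′)
        ≡⟨ cong sumℚ (map-cong split cs′) ⟩
      sumℚ (map (λ d → y c * (proj₁ d * ι (lookup (unitMono c) i)) + y c * (proj₁ d * ι (lookup (proj₂ d) i))) cs′)
        ≡⟨ sumℚ-+ _ _ cs′ ⟩
      sumℚ (map (λ d → y c * (proj₁ d * ι (lookup (unitMono c) i))) cs′) +
      sumℚ (map (λ d → y c * (proj₁ d * ι (lookup (proj₂ d) i))) cs′)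
        ≡⟨ cong₂ _+_ (trans (sumℚ-*ˡ (y c) _ cs′) (cong (y c *_) (sumℚ-convex cs′ _ ∑λ′≡1)))
                     (trans (sumℚ-*ˡ (y c) _ cs′) (cong (y c *_) (t′≡ i))) ⟩
      y c * ι (lookup (unitMono c) i) + y c * t′ i ∎
      where
      open +-*-Solver using (solve; _:+_; _:*_; _:=_)
      distrib : ∀ p q r s → p * q * (r + s) ≡ p * (q * r) + p * (q * s)
      distrib = solve 4 (λ p q r s → p :* q :* (r :+ s) := p :* (q :* r) :+ p :* (q :* s)) refl
      split : ∀ d → y c * proj₁ d * ι (lookup (zipWith ℕ._+_ (unitMono c) (proj₂ d)) i) ≡
                    y c * (proj₁ d * ι (lookup (unitMono c) i)) + y c * (proj₁ d * ι (lookup (proj₂ d) i))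
      split d = trans (cong (λ k → y c * proj₁ d * ι k) (VecP.lookup-zipWith ℕ._+_ i (unitMono c) (proj₂ d)))
                      (trans (cong (y c * proj₁ d *_) (ι-+ (lookup (unitMono c) i) (lookup (proj₂ d) i)))
                             (distrib (y c) (proj₁ d) _ _))

    y-as-delta : ∀ i → intervalSum (λ c → y c * ι (lookup (unitMono c) i)) A B ≡ y i
    y-as-delta i = trans (∑ℚ.sum-cong-≗ pointwise) (∑ℚ-delta y i)
      where
      unit-at : ∀ c → lookup (unitMono c) i ≡ (if does (i ≟ c) then 1 else 0)
      unit-at c = VecP.lookup∘tabulate _ i
      pointwise : ∀ c → (if inInterval A B c then y c * ι (lookup (unitMono c) i) else 0ℚ) ≡ (if does (c ≟ i) then y c else 0ℚ)
      pointwise c with c ≟ i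
      ... | yes refl rewrite unit-at c | dec-true (c ≟ c) refl with inInterval A B c in eq
      ...   | true  = ℚP.*-identityʳ (y c)
      ...   | false = sym (y-outside c λ (A≤c , c<B) →
                          contradiction (trans (sym eq) (inInterval-true {l = A} {B} {c} A≤c c<B)) λ ())
      pointwise c | no c≢i rewrite unit-at c | dec-false (i ≟ c) (c≢i ∘ sym) with inInterval A B c
      ...   | true  = ℚP.*-zeroʳ (y c)
      ...   | false = refl

    coordinates : ∀ i → sumℚ (map (λ e → proj₁ e * ι (lookup (proj₂ e) i)) cs) ≡ y i + t′ i
    coordinates i = begin
      sumℚ (map (λ e → proj₁ e * ι (lookup (proj₂ e) i)) cs)
        ≡⟨ sumℚ-concatMap _ spread positions ⟩
      sumℚ (map (λ c → sumℚ (map (λ e → proj₁ e * ι (lookup (proj₂ e) i)) (spread c))) positions)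
        ≡⟨ cong sumℚ (map-cong (coordinate-spread i) positions) ⟩
      sumℚ (map (λ c → y c * ι (lookup (unitMono c) i) + y c * t′ i) positions)
        ≡⟨ sumℚ-+ _ _ positions ⟩
      sumℚ (map (λ c → y c * ι (lookup (unitMono c) i)) positions) + sumℚ (map (λ c → y c * t′ i) positions)
        ≡⟨ cong₂ _+_ (trans (sum-positions _) (y-as-delta i))
                     (trans (sumℚ-*ʳ (t′ i) y positions)
                            (trans (cong (_* t′ i) (trans (sum-positions y) Σy≡1)) (ℚP.*-identityˡ (t′ i)))) ⟩
      y i + t′ i ∎

module HallTheorem where

  open import Data.Nat as ℕ using (ℕ; suc; z≤n)
  import Data.Nat.Properties as ℕP
  open import Data.Fin as Fin using (Fin; toℕ)
  open import Data.Fin.Properties using (toℕ<n)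
  open import Data.Product using (_×_; _,_; proj₁; proj₂; ∃)
  open import Data.List as List using (List; []; _∷_; _++_; length)
  open import Data.List.Relation.Unary.All as All using (All; []; _∷_)
  open import Data.List.Relation.Unary.All.Properties using (++⁺; ++⁻)
  open import Data.Vec using (replicate)
  open import Data.Vec.Properties using (lookup-replicate)
  open import Data.Rational as ℚ using (ℚ; 0ℚ; 1ℚ; _+_; _*_; _≤_)
  import Data.Rational.Properties as ℚP
  open import Relation.Binary.PropositionalEquality
  open import Relation.Nullary using (yes; no)
  open Counting using (length-insert)
  open ChainMonomials using ([])
  open Rationals
  open IntervalSums
  open HallConditions
  open MinkowskiSums

  private variable
    n : ℕ

  ≤-intervalSum : ∀ (t : Fin n → ℚ) → (∀ j → 0ℚ ≤ t j) → ∀ {l r} i → l ℕ.≤ toℕ i → toℕ i ℕ.< r → t i ≤ intervalSum t l r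
  ≤-intervalSum t 0≤t {l} {r} i l≤i i<r = begin
    t i                                                          ≡⟨ ℚP.+-identityˡ (t i) ⟨
    0ℚ + t i                                                     ≤⟨ ℚP.+-monoˡ-≤ (t i) (intervalSum-nonNeg t l (toℕ i) 0≤t) ⟩
    intervalSum t l (toℕ i) + t i                                ≤⟨ ≤-+-nonNeg _ (intervalSum-nonNeg t (suc (toℕ i)) r 0≤t) ⟩
    intervalSum t l (toℕ i) + t i + intervalSum t (suc (toℕ i)) r
      ≡⟨ cong (_+ intervalSum t (suc (toℕ i)) r) (intervalSum-snoc t i refl l≤i) ⟨
    intervalSum t l (suc (toℕ i)) + intervalSum t (suc (toℕ i)) r ≡⟨ intervalSum-split t (ℕP.m≤n⇒m≤1+n l≤i) i<r ⟨
    intervalSum t l r                                            ∎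
    where open ℚP.≤-Reasoning

  InMinkowskiSum-cong : ∀ {J : List (Fin n × Fin n)} {f g} → (∀ i → f i ≡ g i) → InMinkowskiSum J f → InMinkowskiSum J g
  InMinkowskiSum-cong f≗g (cs , valid , ∑λ≡1 , f≡) = cs , valid , ∑λ≡1 , λ i → trans (f≡ i) (f≗g i)

  splitAtMinimalEnd : ∀ (e : Fin n × Fin n) es → ∃ λ L₁ → ∃ λ e′ → ∃ λ L₂ →
    (e ∷ es ≡ L₁ ++ e′ ∷ L₂) × All (λ f → toℕ (proj₂ e′) ℕ.≤ toℕ (proj₂ f)) (L₁ ++ L₂)
  splitAtMinimalEnd e [] = [] , e , [] , refl , []
  splitAtMinimalEnd e (f ∷ fs) with splitAtMinimalEnd f fs
  ... | L₁ , e′ , L₂ , eq , ends≥ with toℕ (proj₂ e) ℕ.≤? toℕ (proj₂ e′)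
  ...   | yes e≤e′ = [] , e , f ∷ fs , refl , subst (All _) (sym eq)
            (++⁺ (All.map (ℕP.≤-trans e≤e′) (proj₁ (++⁻ L₁ ends≥))) (e≤e′ ∷ All.map (ℕP.≤-trans e≤e′) (proj₂ (++⁻ L₁ ends≥))))
  ...   | no e≰e′ = e ∷ L₁ , e′ , L₂ , cong (e ∷_) eq , ℕP.<⇒≤ (ℕP.≰⇒> e≰e′) ∷ ends≥

  Hall⇒InMinkowskiSum : ∀ (J : List (Fin n × Fin n)) → All (λ e → proj₁ e Fin.< proj₂ e) J →
    ∀ t → Hall J t → intervalSum t 0 n ≡ ι (length J) → InMinkowskiSum J t
  Hall⇒InMinkowskiSum {n} J = induct (length J) J refl
    where
    induct : ∀ k J → length J ≡ k → All (λ e → proj₁ e Fin.< proj₂ e) J →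
             ∀ t → Hall J t → intervalSum t 0 n ≡ ι (length J) → InMinkowskiSum J t
    induct _ [] _ _ t hall Σt≡0 =
      ((1ℚ , replicate n 0) ∷ []) , ((ℚP.≤-trans (0≤ι 0) (ι-mono {0} {1} z≤n) , []) ∷ []) , ℚP.+-identityʳ 1ℚ ,
      λ i → trans (cong (λ k → 1ℚ * ι k + 0ℚ) (lookup-replicate i 0)) (sym (t≡0 i))
      where
      t≡0 : ∀ i → t i ≡ 0ℚ
      t≡0 i = ℚP.≤-antisym (subst (t i ≤_) Σt≡0 (≤-intervalSum t (Hall⇒nonNeg [] t hall) i z≤n (toℕ<n i)))
                           (Hall⇒nonNeg [] t hall i)
    induct (suc k) (e ∷ es) length≡ increasing t hall Σt≡ =
      let L₁ , (a , b) , L₂ , eq , ends≥b = splitAtMinimalEnd e es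
          increasing′ = subst (All _) eq increasing
          L₁-inc , ab∷L₂-inc = ++⁻ L₁ increasing′
          a<b = All.head ab∷L₂-inc
          open HallStep L₁ L₂ a<b ends≥b t (subst (λ J → Hall J t) eq hall)
          length′ = ℕP.suc-injective (trans (sym (length-insert L₁ (a , b) L₂)) (trans (cong length (sym eq)) length≡))
          t′∈ = induct k (L₁ ++ L₂) length′ (++⁺ L₁-inc (All.tail ab∷L₂-inc)) t′ hall′
                  (total′ (subst (λ J → intervalSum t 0 n ≡ ι (length J)) eq Σt≡))
      in subst (λ J → InMinkowskiSum J t) (sym eq)
           (InMinkowskiSum-cong (λ i → x+[y-x]≡y (y i) (t i))
             (InMinkowskiSum-insert L₁ L₂ y 0≤y y-outside (intervalSum-y-⊇ _ _ ℕP.≤-refl ℕP.≤-refl) t′∈))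

module PermutahedronInNewton where

  open import Data.Bool using (true; T; if_then_else_)
  open import Data.Bool.Properties using (T-∧)
  import Data.Bool.Properties as BoolP
  open import Data.Nat as ℕ using (ℕ; suc; z≤n; s≤s; _∸_)
  import Data.Nat.Properties as ℕP
  open import Data.Fin as Fin using (Fin; toℕ; fromℕ<)
  open import Data.Fin.Properties using (toℕ<n; toℕ-fromℕ<)
  open import Data.Fin.Subset using (Subset; ⊤)
  open import Data.Product using (_×_; _,_; proj₁; proj₂)
  open import Data.List as List using (map)
  open import Data.List.Relation.Unary.All as All using (All)
  open import Data.Vec as Vec using (lookup)
  open import Data.Vec.Properties using (lookup∘tabulate; lookup-replicate; ≡-dec)
  open import Data.Rational as ℚ using (ℚ; 0ℚ; _≤_)
  import Data.Rational.Properties as ℚP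
  open import Relation.Binary.PropositionalEquality
  open import Relation.Nullary using (Dec; yes; no)
  open import Function using (_⇔_; mk⇔; Equivalence)
  open import Function.Definitions using (Injective)
  open Counting using (count; count-cong; count-true; T⇔T⇒≡; foldr-filterᵇ-tabulate)
  open Inversions using (invCount; len≡invCount)
  open CanonicalChain using (canonicalChain)
  open ChainMonomials using (containsInterval⇔; Choice⇒∈chainWeight)
  open Rationals using (ι)
  open NewtonInPermutahedron using (invCount-⊤)
  open IntervalSums
  open HallConditions using (inside; within; Hall)
  open HallTheorem using (Hall⇒InMinkowskiSum)
  open Support using (saturated⇒increasing; chain⇒coeffD≢0)

  private variable
    n : ℕ

  interval : ℕ → ℕ → Subset n
  interval l r = Vec.tabulate (inInterval l r)

  sumOver≡∑ : ∀ (I : Subset n) t → sumOver I t ≡ ∑ℚ.sum (λ i → if lookup I i then t i else 0ℚ)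
  sumOver≡∑ I t = foldr-filterᵇ-tabulate ℚ._+_ 0ℚ ℚP.+-identityˡ (lookup I) t (λ i → i)

  sumOver-interval : ∀ (t : Pt n) l r → sumOver (interval l r) t ≡ intervalSum t l r
  sumOver-interval t l r = trans (sumOver≡∑ (interval l r) t)
    (∑ℚ.sum-cong-≗ λ i → cong (λ x → if x then t i else 0ℚ) (lookup∘tabulate (inInterval l r) i))

  sumOver-⊤ : ∀ (t : Pt n) → sumOver ⊤ t ≡ intervalSum t 0 n
  sumOver-⊤ {n} t = trans (sumOver≡∑ ⊤ t) (∑ℚ.sum-cong-≗ λ i → cong (λ x → if x then t i else 0ℚ)
    (trans (lookup-replicate i true) (sym (inInterval-true {l = 0} {n} {i} z≤n (toℕ<n i)))))

  containsInterval-interval : ∀ {a b : Fin n} l r → a Fin.< b →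
    containsIntervalᵇ (interval l r) (a , b) ≡ inside l r (a , b)
  containsInterval-interval {n} {a} {b} l r a<b = T⇔T⇒≡ (mk⇔
    (λ t → let ⊆ = Equivalence.to (containsInterval⇔ (interval l r) a b) t
           in Equivalence.from T-∧ (ℕP.≤⇒≤ᵇ (proj₁ (member a ⊆ ℕP.≤-refl a<b)) , ℕP.≤⇒≤ᵇ (b≤r ⊆)))
    (λ t → let l≤a , b≤r = Equivalence.to T-∧ t in Equivalence.from (containsInterval⇔ (interval l r) a b)
             λ i a≤i i<b → subst T (sym (trans (lookup∘tabulate (inInterval l r) i)
               (inInterval-true {l = l} {r} {i} (ℕP.≤-trans (ℕP.≤ᵇ⇒≤ l (toℕ a) l≤a) a≤i)
                                                (ℕP.<-≤-trans i<b (ℕP.≤ᵇ⇒≤ (toℕ b) r b≤r))))) _))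
    where
    member : ∀ i → (∀ j → a Fin.≤ j → j Fin.< b → T (lookup (interval l r) j)) → a Fin.≤ i → i Fin.< b →
             l ℕ.≤ toℕ i × toℕ i ℕ.< r
    member i ⊆ a≤i i<b = inInterval⁻ {l = l} {r} {i} (subst T (lookup∘tabulate (inInterval l r) i) (⊆ i a≤i i<b))
    b≤r : (∀ j → a Fin.≤ j → j Fin.< b → T (lookup (interval l r) j)) → toℕ b ℕ.≤ r
    b≤r ⊆ = subst (ℕ._≤ r) (trans (cong suc (toℕ-fromℕ< b-1<n)) 1+[b∸1]≡b) (proj₂ (member (fromℕ< b-1<n) ⊆ a≤b-1 b-1<b))
      where
      1+[b∸1]≡b : suc (toℕ b ∸ 1) ≡ toℕ b
      1+[b∸1]≡b = ℕP.m+[n∸m]≡n (ℕP.≤-trans (s≤s z≤n) a<b)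
      b-1<n : toℕ b ∸ 1 ℕ.< n
      b-1<n = ℕP.≤-<-trans (ℕP.m∸n≤m (toℕ b) 1) (toℕ<n b)
      a≤b-1 : a Fin.≤ fromℕ< b-1<n
      a≤b-1 = subst (toℕ a ℕ.≤_) (sym (toℕ-fromℕ< b-1<n)) (ℕP.≤-pred (subst (suc (toℕ a) ℕ.≤_) (sym 1+[b∸1]≡b) a<b))
      b-1<b : fromℕ< b-1<n Fin.< b
      b-1<b = subst (ℕ._< toℕ b) (sym (toℕ-fromℕ< b-1<n)) (ℕP.≤-reflexive 1+[b∸1]≡b)

  permutahedron⊆newton : ∀ (w : Perm n) → Injective _≡_ _≡_ w → ∀ t → InGenPerm (zD w) t → InNewton w t
  permutahedron⊆newton {n} w w-inj t (lower , total) =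
    let C , saturated , counts = canonicalChain w-inj
        increasing = saturated⇒increasing C saturated
        length≡ = trans (sym (count-true C)) (trans (counts (λ _ → true)) (sym (len≡invCount w)))
        hall : Hall C t
        hall l r = subst₂ ℚ._≤_ (cong ι (sym (within≡ C counts increasing l r))) (sumOver-interval t l r) (bound (interval l r))
        Σt≡ = trans (sym (sumOver-⊤ t)) (trans total (cong ι (trans (invCount-⊤ w) (sym length≡))))
        cs , valid , ∑λ≡1 , t≡ = Hall⇒InMinkowskiSum C increasing t hall Σt≡
    in cs , All.map (λ (0≤λ , ch) → 0≤λ , chain⇒coeffD≢0 w C saturated length≡ (Choice⇒∈chainWeight ch)) valid , ∑λ≡1 , t≡
    where
    bound : ∀ I → zD w I ≤ sumOver I t
    bound I = by-cases I (≡-dec BoolP._≟_ I ⊤)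
      where
      by-cases : ∀ I → Dec (I ≡ ⊤) → zD w I ≤ sumOver I t
      by-cases _ (yes refl) = ℚP.≤-reflexive (sym total)
      by-cases I (no I≢⊤)   = lower I I≢⊤
    within≡ : ∀ C → (∀ W → count W C ≡ invCount W w) → All (λ e → proj₁ e Fin.< proj₂ e) C →
              ∀ l r → within C l r ≡ invCount (containsIntervalᵇ (interval l r)) w
    within≡ C counts increasing l r = trans (count-cong (All.map (λ {e} a<b → sym (containsInterval-interval l r a<b)) increasing))
                                            (counts (containsIntervalᵇ (interval l r)))

open NewtonInPermutahedron using (newton⊆permutahedron)
open PermutahedronInNewton using (permutahedron⊆newton)

theorem3p19 : (n : ℕ) (w : Perm n) → Injective _≡_ _≡_ w →
    (t : Pt n) → InNewton w t ⇔ InGenPerm (zD w) t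
theorem3p19 n w w-inj t = mk⇔ (newton⊆permutahedron w w-inj t) (permutahedron⊆newton w w-inj t)
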